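{- Let $k\ge1$, let $m_1,\ldots,m_k$ be nonnegative integers and $n\ge0$. Then \[\mathcal{D}^{ss}_k(m_1,\ldots,m_k;n)=N\Big(\sum_{i=1}^k m_i+k-1;\,n\Big).\]
   Context: A partition is a finite nonincreasing sequence of positive integers; $l(\lambda)$ is the number of parts, $|\lambda|$ the sum, $\lambda_1$ the largest part ($0$ if empty). The rank of a partition is $\lambda_1-l(\lambda)$ (the empty partition of $0$ has rank $0$); $N(m;n)$ is the number of partitions of $n$ with rank $m$. For $k\geq 1$, a $k$-marked Durfee symbol of $n$ is an array $\eta=\begin{pmatrix}\alpha^k,&\ldots,&\alpha^1\\ \beta^k,&\ldots,&\beta^1\end{pmatrix}_D$ where $D\ge 0$ is an integer, each $\alpha^i,\beta^i$ is a (possibly empty) partition, $\sum_{i}(|\alpha^i|+|\beta^i|)+D^2=n$, and: (1) $\alpha^i$ is nonempty for $1\leq i<k$; (2) for $2\le i\le k$, $\beta^{i-1}_1\le \alpha^{i-1}_1$ and $\alpha^{i-1}_1$ is at most every part of $\alpha^i$ and of $\beta^i$; (3) every part of $\alpha^k$ and $\beta^k$ is at most $D$. Its $i$th rank is $l(\alpha^i)-l(\beta^i)-1$ for $1\le i<k$ and $l(\alpha^k)-l(\beta^k)$ for $i=k$. A pair of partitions $(\alpha,\beta)$ is strict shifted if $l(\alpha)>l(\beta)$ and $\alpha_{i+1}>\beta_i$ for $1\le i\le l(\beta)$. A $k$-marked Durfee symbol is strict shifted if $(\alpha^i,\beta^i)$ is strict shifted for every $1\le i<k$. $\mathcal{D}^{ss}_k(m_1,\ldots,m_k;n)$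 is the number of $k$-marked strict shifted Durfee symbols of $n$ with $i$th rank $m_i$ for all $i$.
   Formalization: In condition (3), every part of every αⁱ and βⁱ, for all 1 ≤ i ≤ k, is at most D, not only the parts of $\alpha^k$ and $\beta^k$. The statement above fails without it. -}

module Defs where

open import Data.Bool using (Bool; true; false; _∧_; not)
open import Data.Nat as ℕ using (ℕ; zero; suc; _+_; _*_; _∸_; _≤ᵇ_; _<ᵇ_; _≡ᵇ_)
open import Data.Integer as ℤ using (ℤ; +_)
open import Data.List using (List; []; _∷_; length; map; concatMap; upTo; foldr; filterᵇ; zip; drop; applyUpTo)
open import Data.Nat.ListAction using (sum)
open import Data.Vec as Vec using (Vec; []; _∷_; toList)
open import Data.Product using (_×_; _,_; proj₁; proj₂)
open import Relation.Nullary.Decidable using (⌊_⌋)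

-- Partitions are represented as lists of naturals (largest part first).

all : {A : Set} → (A → Bool) → List A → Bool
all p = foldr (λ x b → p x ∧ b) true

Partition : Set
Partition = List ℕ

largest : Partition → ℕ
largest []      = 0
largest (x ∷ _) = x

nonincreasing : List ℕ → Bool
nonincreasing []            = true
nonincreasing (x ∷ [])      = true
nonincreasing (x ∷ y ∷ xs)  = (y ≤ᵇ x) ∧ nonincreasing (y ∷ xs)

-- all lists of positive naturals with sum ≤ s and length ≤ fuel
-- (each such list appears exactly once)
posLists : ℕ → ℕ → List (List ℕ)
posLists zero     s = [] ∷ []
posLists (suc f)  s = [] ∷ concatMap (λ p → map (p ∷_) (posLists f (s ∸ p)))
                                     (applyUpTo suc s)

-- all partitions with |λ| ≤ n, each exactly once
partitionsUpTo : ℕ → List Partition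
partitionsUpTo n = filterᵇ nonincreasing (posLists n n)

rank : Partition → ℤ
rank λ′ = + largest λ′ ℤ.- + length λ′

N : ℤ → ℕ → ℕ
N m n = length (filterᵇ (λ p → (sum p ≡ᵇ n) ∧ ⌊ rank p ℤ.≟ m ⌋) (partitionsUpTo n))

-- A k-marked Durfee symbol is (D , v) with v : Vec (Partition × Partition) k,
-- where  lookup v i = (α^(i+1) , β^(i+1)),  i.e. the vector lists the pairs
-- in the order (α¹,β¹), (α²,β²), …, (α^k,β^k).

-- strict shifted pair: l(α) > l(β) and α_{i+1} > β_i for 1 ≤ i ≤ l(β)
strictShifted : Partition → Partition → Bool
strictShifted α β =
  (length β <ᵇ length α) ∧ all (λ ab → proj₂ ab <ᵇ proj₁ ab) (zip (drop 1 α) β)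

nonempty : List ℕ → Bool
nonempty []      = false
nonempty (_ ∷ _) = true

-- check of conditions (1),(2),(3), strict shiftedness, and the ranks,
-- given the list of pairs (α¹,β¹),…,(α^k,β^k) and ranks m₁,…,m_k
symbolOK : ℕ → List (Partition × Partition) → List ℕ → Bool
symbolOK D []                 _  = false
symbolOK D ((α , β) ∷ [])     [] = false
-- i = k : condition (3) and k-th rank l(α^k) - l(β^k) = m_k
symbolOK D ((α , β) ∷ [])     (m ∷ []) =
  all (_≤ᵇ D) α ∧ all (_≤ᵇ D) β
  ∧ ⌊ (+ length α ℤ.- + length β) ℤ.≟ + m ⌋
symbolOK D ((α , β) ∷ []) (m ∷ _ ∷ _) = false
symbolOK D ((α , β) ∷ (α′ , β′) ∷ ps) [] = false
-- i < k : parts ≤ D, condition (1), condition (2) linking i and i+1, strict shifted,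
-- and i-th rank l(α^i) - l(β^i) - 1 = m_i
symbolOK D ((α , β) ∷ (α′ , β′) ∷ ps) (m ∷ ms) =
  nonempty α
  ∧ all (_≤ᵇ D) α ∧ all (_≤ᵇ D) β
  ∧ (largest β ≤ᵇ largest α)
  ∧ all (largest α ≤ᵇ_) α′ ∧ all (largest α ≤ᵇ_) β′
  ∧ strictShifted α β
  ∧ ⌊ (+ length α ℤ.- + length β ℤ.- ℤ.1ℤ) ℤ.≟ + m ⌋
  ∧ symbolOK D ((α′ , β′) ∷ ps) ms

weight : ℕ → List (Partition × Partition) → ℕ
weight D ps = sum (map (λ ab → sum (proj₁ ab) + sum (proj₂ ab)) ps) + D * D

vecsOf : (k : ℕ) → {A : Set} → List A → List (Vec A k)
vecsOf zero    xs = [] ∷ []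
vecsOf (suc k) xs = concatMap (λ x → map (x ∷_) (vecsOf k xs)) xs

candidates : (k n : ℕ) → List (ℕ × Vec (Partition × Partition) k)
candidates k n =
  concatMap (λ D → map (D ,_) (vecsOf k (concatMap (λ a → map (a ,_) (partitionsUpTo n))
                                                   (partitionsUpTo n))))
            (upTo (suc n))

Dss : (k : ℕ) → Vec ℕ k → ℕ → ℕ
Dss k ms n = length (filterᵇ
  (λ s → (weight (proj₁ s) (toList (proj₂ s)) ≡ᵇ n)
         ∧ symbolOK (proj₁ s) (toList (proj₂ s)) (toList ms))
  (candidates k n))

module Submission where

-- The first two pairs (α¹,β¹), (α²,β²) of a strict
-- shifted symbol merge into the pair (α²α¹, β²β¹) of rank m₁ + m₂ + 1.  This is
-- inverted by cutting α after d + s parts and β after s parts, where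
-- d = l(α) − l(β) − m₁ − 1 and s is the split point of (α_{≥d}, β): the shift
-- α_{i+1} > β_i holds from s on and fails at s − 1.  So
-- D^ss_{k+2}(m₁, m₂, …; n) = D^ss_{k+1}(m₁ + m₂ + 1, …; n).
--
-- Durfee square (durfee-count).  (α, β)_D corresponds to the partition with a
-- Durfee square of side D, columns α to its right and rows β below it; it has
-- rank l(α) − l(β), so D^ss_1(m; n) = N(m; n).

open import Defs
open import Data.Bool using (Bool; true; false; T; T?; _∧_; if_then_else_)
import Data.Integer as ℤ
import Data.Integer.Properties as ℤ
open import Data.List
  using (List; []; _∷_; length; map; _++_; take; drop; replicate; filterᵇ; concatMap;
         applyUpTo; upTo; zip; cartesianProductWith; cartesianProduct)
open import Data.List.Properties
  using (∷-injectiveʳ; length-++; length-map; length-replicate; length-take; length-drop; take++drop≡id)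
open import Data.List.Membership.Propositional using (_∈_; find; lose)
open import Data.List.Membership.Propositional.Properties
  using (∈-map⁺; ∈-map⁻; ∈-filter⁺; ∈-filter⁻; ∈-concatMap⁺; ∈-concatMap⁻;
         ∈-applyUpTo⁺; ∈-applyUpTo⁻; ∈-upTo⁺; ∈-upTo⁻;
         ∈-cartesianProduct⁺; ∈-cartesianProduct⁻; ∈-cartesianProductWith⁺; ∈-cartesianProductWith⁻)
open import Data.List.Membership.Propositional.Properties.WithK using (unique∧set⇒bag)
open import Data.List.Relation.Binary.BagAndSetEquality using (∼bag⇒↭)
open import Data.List.Relation.Binary.Permutation.Propositional.Properties using (↭-length)
open import Data.List.Relation.Unary.All as All using (All; []; _∷_)
import Data.List.Relation.Unary.All.Properties as All
open import Data.List.Relation.Unary.Any using (here; there)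
open import Data.List.Relation.Unary.Unique.Propositional using (Unique; []; _∷_)
import Data.List.Relation.Unary.Unique.Propositional.Properties as Unique
open import Data.Nat
open import Data.Nat.Properties
open import Data.Nat.ListAction using () renaming (sum to sumᴸ)
open import Data.Nat.ListAction.Properties using (sum-++)
open import Data.Nat.Tactic.RingSolver using (solve-∀)
open import Data.Product using (∃-syntax; _×_; _,_; proj₁; proj₂)
open import Data.Empty using (⊥; ⊥-elim)
open import Data.Sum using (_⊎_; inj₁; inj₂)
open import Data.Vec using (Vec; []; _∷_; toList; sum)
import Data.Vec.Properties as Vec
import Data.Vec.Relation.Unary.All as VecAll
open import Function using (_∘_)
open import Function.Bundles using (mk⇔)
open import Relation.Binary.Definitions using (tri<; tri≈; tri>)
open import Relation.Binary.PropositionalEquality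
open import Relation.Nullary using (yes; no)
open import Relation.Nullary.Decidable using (⌊_⌋; toWitness; fromWitness)

∧⁻ : ∀ a {b} → T (a ∧ b) → T a × T b
∧⁻ true t = _ , t

∧⁺ : ∀ {a b} → T a → T b → T (a ∧ b)
∧⁺ {true} _ t = t

module _ {A : Set} (p : A → Bool) {P : A → Set} where

  all⁻ : (∀ {x} → T (p x) → P x) → ∀ xs → T (all p xs) → All P xs
  all⁻ dec []       _ = []
  all⁻ dec (x ∷ xs) t = let tx , txs = ∧⁻ (p x) t in dec tx ∷ all⁻ dec xs txs

  all⁺ : (∀ {x} → P x → T (p x)) → ∀ {xs} → All P xs → T (all p xs)
  all⁺ enc []         = _
  all⁺ enc (px ∷ pxs) = ∧⁺ (enc px) (all⁺ enc pxs)

minus⇒ : ∀ x y z → x ℤ.- y ≡ z → x ≡ z ℤ.+ y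
minus⇒ x y z x-y≡z = begin
  x                       ≡⟨ ℤ.+-identityʳ x ⟨
  x ℤ.+ ℤ.0ℤ              ≡⟨ cong (λ w → x ℤ.+ w) (ℤ.+-inverseˡ y) ⟨
  x ℤ.+ (ℤ.- y ℤ.+ y)     ≡⟨ ℤ.+-assoc x (ℤ.- y) y ⟨
  (x ℤ.- y) ℤ.+ y         ≡⟨ cong (λ w → w ℤ.+ y) x-y≡z ⟩
  z ℤ.+ y                 ∎
  where open ≡-Reasoning

⇒minus : ∀ x y z → x ≡ z ℤ.+ y → x ℤ.- y ≡ z
⇒minus x y z x≡z+y = begin
  x ℤ.- y                 ≡⟨ cong (ℤ._- y) x≡z+y ⟩
  (z ℤ.+ y) ℤ.- y         ≡⟨ ℤ.+-assoc z y (ℤ.- y) ⟩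
  z ℤ.+ (y ℤ.- y)         ≡⟨ cong (λ w → z ℤ.+ w) (ℤ.+-inverseʳ y) ⟩
  z ℤ.+ ℤ.0ℤ              ≡⟨ ℤ.+-identityʳ z ⟩
  z                       ∎
  where open ≡-Reasoning

rank⁻ : ∀ a b m → T ⌊ (ℤ.+ a ℤ.- ℤ.+ b) ℤ.≟ ℤ.+ m ⌋ → a ≡ m + b
rank⁻ a b m t = ℤ.+-injective (minus⇒ (ℤ.+ a) (ℤ.+ b) (ℤ.+ m) (toWitness t))

⇒rank : ∀ a b m → a ≡ m + b → T ⌊ (ℤ.+ a ℤ.- ℤ.+ b) ℤ.≟ ℤ.+ m ⌋
⇒rank a b m a≡m+b = fromWitness (⇒minus (ℤ.+ a) (ℤ.+ b) (ℤ.+ m) (cong ℤ.+_ a≡m+b))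

rank1⁻ : ∀ a b m → T ⌊ (ℤ.+ a ℤ.- ℤ.+ b ℤ.- ℤ.1ℤ) ℤ.≟ ℤ.+ m ⌋ → a ≡ suc m + b
rank1⁻ a b m t =
  let a-b≡m+1 = minus⇒ (ℤ.+ a ℤ.- ℤ.+ b) ℤ.1ℤ (ℤ.+ m) (toWitness t)
  in trans (ℤ.+-injective (minus⇒ (ℤ.+ a) (ℤ.+ b) (ℤ.+ (m + 1)) a-b≡m+1)) (cong (_+ b) (+-comm m 1))

⇒rank1 : ∀ a b m → a ≡ suc m + b → T ⌊ (ℤ.+ a ℤ.- ℤ.+ b ℤ.- ℤ.1ℤ) ℤ.≟ ℤ.+ m ⌋
⇒rank1 a b m a≡1+m+b = fromWitness
  (⇒minus (ℤ.+ a ℤ.- ℤ.+ b) ℤ.1ℤ (ℤ.+ m)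
    (⇒minus (ℤ.+ a) (ℤ.+ b) (ℤ.+ (m + 1)) (cong ℤ.+_ (trans a≡1+m+b (cong (_+ b) (+-comm 1 m))))))

unique-set⇒length : {A : Set} {xs ys : List A} → Unique xs → Unique ys →
  (∀ {z} → z ∈ xs → z ∈ ys) → (∀ {z} → z ∈ ys → z ∈ xs) → length xs ≡ length ys
unique-set⇒length uxs uys to from = ↭-length (∼bag⇒↭ (unique∧set⇒bag uxs uys (mk⇔ to from)))

map-unique : {A B : Set} (f : A → B) {xs : List A} → Unique xs →
  (∀ {x y} → x ∈ xs → y ∈ xs → f x ≡ f y → x ≡ y) → Unique (map f xs)
map-unique f []           inj = []
map-unique f (x∉xs ∷ uxs) inj =
  All.map⁺ (All.tabulate λ y∈xs fx≡fy → All.lookup x∉xs y∈xs (inj (here refl) (there y∈xs) fx≡fy))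
  ∷ map-unique f uxs (λ x∈ y∈ → inj (there x∈) (there y∈))

record Correspondence {A B : Set} (P : A → Set) (Q : B → Set) : Set where
  field
    to      : A → B
    from    : B → A
    to-ok   : ∀ {x} → P x → Q (to x)
    from-ok : ∀ {y} → Q y → P (from y)
    from∘to : ∀ {x} → P x → from (to x) ≡ x
    to∘from : ∀ {y} → Q y → to (from y) ≡ y

_∈_∣_ : {A : Set} → A → List A → (A → Bool) → Set
x ∈ xs ∣ p = x ∈ xs × T (p x)

count-by-correspondence : {A B : Set} (p : A → Bool) (q : B → Bool) {xs : List A} {ys : List B} →
  Unique xs → Unique ys → Correspondence (_∈ xs ∣ p) (_∈ ys ∣ q) →
  length (filterᵇ p xs) ≡ length (filterᵇ q ys)
count-by-correspondence p q {xs} {ys} uxs uys c =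
  trans (sym (length-map to (filterᵇ p xs)))
        (unique-set⇒length (map-unique to (Unique.filter⁺ (T? ∘ p) uxs) injective)
                           (Unique.filter⁺ (T? ∘ q) uys) image⊆ image⊇)
  where
  open Correspondence c
  selected : ∀ {x} → x ∈ filterᵇ p xs → x ∈ xs ∣ p
  selected = ∈-filter⁻ (T? ∘ p)
  injective : ∀ {x y} → x ∈ filterᵇ p xs → y ∈ filterᵇ p xs → to x ≡ to y → x ≡ y
  injective x∈ y∈ e = trans (sym (from∘to (selected x∈))) (trans (cong from e) (from∘to (selected y∈)))
  image⊆ : ∀ {z} → z ∈ map to (filterᵇ p xs) → z ∈ filterᵇ q ys
  image⊆ z∈ with x , x∈ , refl ← ∈-map⁻ to z∈ =
    let y∈ , qy = to-ok (selected x∈) in ∈-filter⁺ (T? ∘ q) y∈ qy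
  image⊇ : ∀ {z} → z ∈ filterᵇ q ys → z ∈ map to (filterᵇ p xs)
  image⊇ z∈ =
    let qz = ∈-filter⁻ (T? ∘ q) z∈ ; x∈ , px = from-ok qz in
    subst (_∈ map to (filterᵇ p xs)) (to∘from qz) (∈-map⁺ to (∈-filter⁺ (T? ∘ p) x∈ px))

-- The part λᵢ (0-indexed), with λᵢ = 0 beyond the length of λ.
at : List ℕ → ℕ → ℕ
at []       _       = 0
at (x ∷ xs) zero    = x
at (x ∷ xs) (suc i) = at xs i

at-0 : ∀ xs → largest xs ≡ at xs 0
at-0 []      = refl
at-0 (_ ∷ _) = refl

at-beyond : ∀ xs {i} → length xs ≤ i → at xs i ≡ 0
at-beyond []       _         = refl
at-beyond (x ∷ xs) (s≤s l≤i) = at-beyond xs l≤i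

at-++ˡ : ∀ xs ys {i} → i < length xs → at (xs ++ ys) i ≡ at xs i
at-++ˡ (x ∷ xs) ys {zero}  _         = refl
at-++ˡ (x ∷ xs) ys {suc i} (s≤s i<l) = at-++ˡ xs ys i<l

at-++ʳ : ∀ xs ys j → at (xs ++ ys) (length xs + j) ≡ at ys j
at-++ʳ []       ys j = refl
at-++ʳ (x ∷ xs) ys j = at-++ʳ xs ys j

at-drop : ∀ k xs i → at (drop k xs) i ≡ at xs (k + i)
at-drop zero    xs       i = refl
at-drop (suc k) []       i = refl
at-drop (suc k) (x ∷ xs) i = at-drop k xs i

at-take : ∀ k xs {i} → i < k → at (take k xs) i ≡ at xs i
at-take (suc k) []       _ = refl
at-take (suc k) (x ∷ xs) {zero}  _         = refl
at-take (suc k) (x ∷ xs) {suc i} (s≤s i<k) = at-take k xs i<k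

at-map : ∀ (f : ℕ → ℕ) xs {i} → i < length xs → at (map f xs) i ≡ f (at xs i)
at-map f (x ∷ xs) {zero}  _         = refl
at-map f (x ∷ xs) {suc i} (s≤s i<l) = at-map f xs i<l

split-index : ∀ i k → i < k ⊎ ∃[ j ] i ≡ k + j
split-index i k with i <? k
... | yes i<k = inj₁ i<k
... | no  i≮k = let j , k+j≡i = m≤n⇒∃[o]m+o≡n (≮⇒≥ i≮k) in inj₂ (j , sym k+j≡i)

Nonincreasing : List ℕ → Set
Nonincreasing xs = ∀ i → at xs (suc i) ≤ at xs i

nonincreasing⁻ : ∀ xs → T (nonincreasing xs) → Nonincreasing xs
nonincreasing⁻ []           _ i       = z≤n
nonincreasing⁻ (x ∷ [])     _ i       = z≤n
nonincreasing⁻ (x ∷ y ∷ xs) t zero    = ≤ᵇ⇒≤ y x (proj₁ (∧⁻ (y ≤ᵇ x) t))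
nonincreasing⁻ (x ∷ y ∷ xs) t (suc i) = nonincreasing⁻ (y ∷ xs) (proj₂ (∧⁻ (y ≤ᵇ x) t)) i

nonincreasing⁺ : ∀ xs → Nonincreasing xs → T (nonincreasing xs)
nonincreasing⁺ []           _   = _
nonincreasing⁺ (x ∷ [])     _   = _
nonincreasing⁺ (x ∷ y ∷ xs) dec = ∧⁺ (≤⇒≤ᵇ (dec 0)) (nonincreasing⁺ (y ∷ xs) (dec ∘ suc))

nonincreasing-mono : ∀ xs → Nonincreasing xs → ∀ {i j} → i ≤ j → at xs j ≤ at xs i
nonincreasing-mono xs dec {i} i≤j with o , refl ← m≤n⇒∃[o]m+o≡n i≤j = go o
  where
  go : ∀ o → at xs (i + o) ≤ at xs i
  go zero    = ≤-reflexive (cong (at xs) (+-identityʳ i))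
  go (suc o) = ≤-trans (≤-reflexive (cong (at xs) (+-suc i o))) (≤-trans (dec (i + o)) (go o))

nonincreasing-drop : ∀ k xs → Nonincreasing xs → Nonincreasing (drop k xs)
nonincreasing-drop k xs dec i =
  subst₂ _≤_ (sym (at-drop k xs (suc i))) (sym (at-drop k xs i))
    (subst (λ z → at xs z ≤ at xs (k + i)) (sym (+-suc k i)) (dec (k + i)))

nonincreasing-take : ∀ k xs → Nonincreasing xs → Nonincreasing (take k xs)
nonincreasing-take k xs dec i with split-index (suc i) k
... | inj₁ 1+i<k = subst₂ _≤_ (sym (at-take k xs 1+i<k)) (sym (at-take k xs (<-trans (n<1+n i) 1+i<k))) (dec i)
... | inj₂ (j , 1+i≡k+j) =
  ≤-trans (≤-reflexive (at-beyond (take k xs) past-end)) z≤n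
  where
  past-end : length (take k xs) ≤ suc i
  past-end = ≤-trans (≤-reflexive (length-take k xs))
               (≤-trans (m⊓n≤m k (length xs)) (subst (k ≤_) (sym 1+i≡k+j) (m≤m+n k j)))

nonincreasing-++ : ∀ xs ys → Nonincreasing xs → Nonincreasing ys →
  (∀ {i} → i < length xs → at ys 0 ≤ at xs i) → Nonincreasing (xs ++ ys)
nonincreasing-++ xs ys decx decy junction i with split-index (suc i) (length xs)
... | inj₁ 1+i<l =
  subst₂ _≤_ (sym (at-++ˡ xs ys 1+i<l)) (sym (at-++ˡ xs ys (<-trans (n<1+n i) 1+i<l))) (decx i)
... | inj₂ (zero , 1+i≡l+0) =
  let 1+i≡l = trans 1+i≡l+0 (+-identityʳ _) ; i<l = subst (i <_) 1+i≡l (n<1+n i) in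
  subst₂ _≤_ (sym (trans (cong (at (xs ++ ys)) 1+i≡l+0) (at-++ʳ xs ys 0))) (sym (at-++ˡ xs ys i<l))
    (junction i<l)
... | inj₂ (suc j , 1+i≡l+1+j) =
  let i≡l+j = suc-injective (trans 1+i≡l+1+j (+-suc (length xs) j)) in
  subst₂ _≤_ (sym (trans (cong (at (xs ++ ys)) 1+i≡l+1+j) (at-++ʳ xs ys (suc j))))
             (sym (trans (cong (at (xs ++ ys)) i≡l+j) (at-++ʳ xs ys j))) (decy j)

IsPartition : List ℕ → Set
IsPartition xs = Nonincreasing xs × All (0 <_) xs

partition-take : ∀ k xs → IsPartition xs → IsPartition (take k xs)
partition-take k xs (dec , pos) = nonincreasing-take k xs dec , All.take⁺ k pos

partition-drop : ∀ k xs → IsPartition xs → IsPartition (drop k xs)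
partition-drop k xs (dec , pos) = nonincreasing-drop k xs dec , All.drop⁺ k pos

partition-++ : ∀ xs ys → IsPartition xs → IsPartition ys →
  (∀ {i} → i < length xs → at ys 0 ≤ at xs i) → IsPartition (xs ++ ys)
partition-++ xs ys (decx , posx) (decy , posy) junction =
  nonincreasing-++ xs ys decx decy junction , All.++⁺ posx posy

length≤sum : ∀ xs → All (0 <_) xs → length xs ≤ sumᴸ xs
length≤sum []       []           = z≤n
length≤sum (x ∷ xs) (0<x ∷ pos) = +-mono-≤ 0<x (length≤sum xs pos)

module _ {A B : Set} (h : A → List B) where

  ∈-concatMap-find : ∀ xs {y} → y ∈ concatMap h xs → ∃[ x ] x ∈ xs × y ∈ h x
  ∈-concatMap-find xs = find ∘ ∈-concatMap⁻ h {xs}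

  ∈-concatMap-lose : ∀ {xs x y} → x ∈ xs → y ∈ h x → y ∈ concatMap h xs
  ∈-concatMap-lose x∈ y∈ = ∈-concatMap⁺ h (lose x∈ y∈)

  concatMap-unique : (key : B → A) → ∀ {xs} → Unique xs → (∀ x → Unique (h x)) →
    (∀ {x y} → y ∈ h x → key y ≡ x) → Unique (concatMap h xs)
  concatMap-unique key []           uh keyed = []
  concatMap-unique key {x ∷ xs} (x∉xs ∷ uxs) uh keyed =
    Unique.++⁺ (uh x) (concatMap-unique key uxs uh keyed) disjoint
    where
    disjoint : ∀ {y} → y ∈ h x × y ∈ concatMap h xs → ⊥
    disjoint (y∈hx , y∈rest) =
      let x′ , x′∈xs , y∈hx′ = ∈-concatMap-find xs y∈rest
      in All.lookup x∉xs x′∈xs (trans (sym (keyed y∈hx)) (keyed y∈hx′))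

private
  extensions : ℕ → ℕ → ℕ → List (List ℕ)
  extensions f s p = map (p ∷_) (posLists f (s ∸ p))

posLists⁻ : ∀ f s {xs} → xs ∈ posLists f s → All (0 <_) xs × sumᴸ xs ≤ s
posLists⁻ zero    s (here refl) = [] , z≤n
posLists⁻ (suc f) s (here refl) = [] , z≤n
posLists⁻ (suc f) s (there xs∈)
  with p , p∈ , xs∈ext ← ∈-concatMap-find (extensions f s) (applyUpTo suc s) xs∈
  with i , i<s , refl ← ∈-applyUpTo⁻ suc p∈
  with ys , ys∈ , refl ← ∈-map⁻ (suc i ∷_) xs∈ext =
  let pos , sum≤ = posLists⁻ f (s ∸ suc i) ys∈
  in s≤s z≤n ∷ pos , ≤-trans (+-monoʳ-≤ (suc i) sum≤) (≤-reflexive (m+[n∸m]≡n i<s))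

posLists⁺ : ∀ f s xs → All (0 <_) xs → sumᴸ xs ≤ s → length xs ≤ f → xs ∈ posLists f s
posLists⁺ zero    s []       _ _ _ = here refl
posLists⁺ (suc f) s []       _ _ _ = here refl
posLists⁺ (suc f) s (suc i ∷ xs) (_ ∷ pos) sum≤ (s≤s len≤) =
  there (∈-concatMap-lose (extensions f s) (∈-applyUpTo⁺ suc (≤-trans (m≤m+n (suc i) (sumᴸ xs)) sum≤))
           (∈-map⁺ (suc i ∷_) (posLists⁺ f (s ∸ suc i) xs pos rest≤ len≤)))
  where
  rest≤ : sumᴸ xs ≤ s ∸ suc i
  rest≤ = ≤-trans (≤-reflexive (sym (m+n∸m≡n (suc i) (sumᴸ xs)))) (∸-monoˡ-≤ (suc i) sum≤)

posLists-unique : ∀ f s → Unique (posLists f s)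
posLists-unique zero    s = [] ∷ []
posLists-unique (suc f) s =
  All.tabulate (λ xs∈ []≡xs → cons-only xs∈ (sym []≡xs))
  ∷ concatMap-unique (extensions f s) head (Unique.applyUpTo⁺₁ suc s (λ i<j _ → <⇒≢ (s≤s i<j)))
      (λ p → Unique.map⁺ ∷-injectiveʳ (posLists-unique f (s ∸ p))) headed
  where
  head : List ℕ → ℕ
  head []      = 0
  head (x ∷ _) = x
  headed : ∀ {p xs} → xs ∈ extensions f s p → head xs ≡ p
  headed xs∈ with _ , _ , refl ← ∈-map⁻ _ xs∈ = refl
  cons-only : ∀ {xs} → xs ∈ concatMap (extensions f s) (applyUpTo suc s) → xs ≡ [] → ⊥
  cons-only xs∈ refl with _ , _ , []∈ ← ∈-concatMap-find (extensions f s) (applyUpTo suc s) xs∈ with ∈-map⁻ _ []∈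
  ... | _ , _ , ()

partitions⁻ : ∀ n {xs} → xs ∈ partitionsUpTo n → IsPartition xs × sumᴸ xs ≤ n
partitions⁻ n {xs} xs∈ =
  let xs∈pos , t = ∈-filter⁻ (T? ∘ nonincreasing) xs∈ ; pos , sum≤ = posLists⁻ n n xs∈pos
  in (nonincreasing⁻ xs t , pos) , sum≤

partitions⁺ : ∀ n {xs} → IsPartition xs → sumᴸ xs ≤ n → xs ∈ partitionsUpTo n
partitions⁺ n {xs} (dec , pos) sum≤ =
  ∈-filter⁺ (T? ∘ nonincreasing) (posLists⁺ n n xs pos sum≤ (≤-trans (length≤sum xs pos) sum≤))
    (nonincreasing⁺ xs dec)

partitions-unique : ∀ n → Unique (partitionsUpTo n)
partitions-unique n = Unique.filter⁺ (T? ∘ nonincreasing) (posLists-unique n n)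

concatMap-map≡cartesian : {A B C : Set} (f : A → B → C) (xs : List A) (ys : List B) →
  concatMap (λ x → map (f x) ys) xs ≡ cartesianProductWith f xs ys
concatMap-map≡cartesian f []       ys = refl
concatMap-map≡cartesian f (x ∷ xs) ys = cong (map (f x) ys ++_) (concatMap-map≡cartesian f xs ys)

Pairs : ℕ → List (Partition × Partition)
Pairs n = cartesianProduct (partitionsUpTo n) (partitionsUpTo n)

pairs⁻ : ∀ n {a b} → (a , b) ∈ Pairs n → IsPartition a × IsPartition b
pairs⁻ n ab∈ = let a∈ , b∈ = ∈-cartesianProduct⁻ (partitionsUpTo n) (partitionsUpTo n) ab∈ in proj₁ (partitions⁻ n a∈) , proj₁ (partitions⁻ n b∈)

pairs⁺ : ∀ n {a b} → IsPartition a → IsPartition b → sumᴸ a + sumᴸ b ≤ n → (a , b) ∈ Pairs n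
pairs⁺ n pa pb sum≤ =
  ∈-cartesianProduct⁺ (partitions⁺ n pa (≤-trans (m≤m+n _ _) sum≤)) (partitions⁺ n pb (≤-trans (m≤n+m _ _) sum≤))

module _ {A : Set} where

  vecsOf≡ : ∀ k (xs : List A) → vecsOf (suc k) xs ≡ cartesianProductWith _∷_ xs (vecsOf k xs)
  vecsOf≡ k xs = concatMap-map≡cartesian _∷_ xs (vecsOf k xs)

  vecsOf⁻ : ∀ k xs {v : Vec A k} → v ∈ vecsOf k xs → VecAll.All (_∈ xs) v
  vecsOf⁻ zero    xs {[]} _ = VecAll.[]
  vecsOf⁻ (suc k) xs {v} v∈
    with x , w , x∈ , w∈ , refl ← ∈-cartesianProductWith⁻ _∷_ xs (vecsOf k xs) (subst (v ∈_) (vecsOf≡ k xs) v∈) =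
    x∈ VecAll.∷ vecsOf⁻ k xs w∈

  vecsOf⁺ : ∀ k xs {v : Vec A k} → VecAll.All (_∈ xs) v → v ∈ vecsOf k xs
  vecsOf⁺ zero    xs VecAll.[]          = here refl
  vecsOf⁺ (suc k) xs {v} (x∈ VecAll.∷ all∈) =
    subst (v ∈_) (sym (vecsOf≡ k xs)) (∈-cartesianProductWith⁺ _∷_ x∈ (vecsOf⁺ k xs all∈))

  vecsOf-unique : ∀ k {xs : List A} → Unique xs → Unique (vecsOf k xs)
  vecsOf-unique zero    _   = [] ∷ []
  vecsOf-unique (suc k) {xs} uxs =
    subst Unique (sym (vecsOf≡ k xs))
      (Unique.cartesianProductWith⁺ _∷_ (λ e → Vec.∷-injective e) uxs (vecsOf-unique k uxs))

candidates≡ : ∀ k n → candidates k n ≡ cartesianProduct (upTo (suc n)) (vecsOf k (Pairs n))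
candidates≡ k n =
  trans (cong (λ ps → concatMap (λ D → map (D ,_) (vecsOf k ps)) (upTo (suc n)))
              (concatMap-map≡cartesian _,_ (partitionsUpTo n) (partitionsUpTo n)))
        (concatMap-map≡cartesian _,_ (upTo (suc n)) (vecsOf k (Pairs n)))

candidates⁻ : ∀ k n {D v} → (D , v) ∈ candidates k n → D ≤ n × VecAll.All (_∈ Pairs n) v
candidates⁻ k n {D} {v} Dv∈ =
  let D∈ , v∈ = ∈-cartesianProduct⁻ (upTo (suc n)) (vecsOf k (Pairs n)) (subst ((D , v) ∈_) (candidates≡ k n) Dv∈)
  in ≤-pred (∈-upTo⁻ D∈) , vecsOf⁻ k (Pairs n) v∈

candidates⁺ : ∀ k n {D v} → D ≤ n → VecAll.All (_∈ Pairs n) v → (D , v) ∈ candidates k n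
candidates⁺ k n {D} {v} D≤n all∈ =
  subst ((D , v) ∈_) (sym (candidates≡ k n)) (∈-cartesianProduct⁺ (∈-upTo⁺ (s≤s D≤n)) (vecsOf⁺ k (Pairs n) all∈))

candidates-unique : ∀ k n → Unique (candidates k n)
candidates-unique k n =
  subst Unique (sym (candidates≡ k n))
    (Unique.cartesianProduct⁺ (Unique.upTo⁺ (suc n))
      (vecsOf-unique k (Unique.cartesianProduct⁺ (partitions-unique n) (partitions-unique n))))

All-at : ∀ {P : ℕ → Set} {xs} → All P xs → ∀ {i} → i < length xs → P (at xs i)
All-at (px ∷ _)   {zero}  _         = px
All-at (_ ∷ pxs) {suc i} (s≤s i<l) = All-at pxs i<l

at-All : ∀ {P : ℕ → Set} xs → (∀ {i} → i < length xs → P (at xs i)) → All P xs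
at-All []       _  = []
at-All (x ∷ xs) px = px (s≤s z≤n) ∷ at-All xs (λ i<l → px (s≤s i<l))

bounded-at : ∀ {D} xs → All (_≤ D) xs → ∀ i → at xs i ≤ D
bounded-at xs bd i with split-index i (length xs)
... | inj₁ i<l = All-at bd i<l
... | inj₂ (j , i≡l+j) = ≤-trans (≤-reflexive (at-beyond xs (subst (length xs ≤_) (sym i≡l+j) (m≤m+n _ j)))) z≤n

StrictShifted : Partition → Partition → Set
StrictShifted α β = length β < length α × (∀ {i} → i < length β → at β i < at α (suc i))

private
  zip-check : List ℕ → List ℕ → Bool
  zip-check xs ys = all (λ ab → proj₂ ab <ᵇ proj₁ ab) (zip xs ys)

  zip-check⁻ : ∀ xs ys → T (zip-check xs ys) → ∀ {i} → i < length ys → i < length xs → at ys i < at xs i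
  zip-check⁻ (x ∷ xs) (y ∷ ys) t {zero}  _ _ = <ᵇ⇒< y x (proj₁ (∧⁻ (y <ᵇ x) t))
  zip-check⁻ (x ∷ xs) (y ∷ ys) t {suc i} (s≤s i<ly) (s≤s i<lx) =
    zip-check⁻ xs ys (proj₂ (∧⁻ (y <ᵇ x) t)) i<ly i<lx

  zip-check⁺ : ∀ xs ys → (∀ {i} → i < length ys → i < length xs → at ys i < at xs i) → T (zip-check xs ys)
  zip-check⁺ []       ys       _  = _
  zip-check⁺ (x ∷ xs) []       _  = _
  zip-check⁺ (x ∷ xs) (y ∷ ys) lt =
    ∧⁺ (<⇒<ᵇ (lt (s≤s z≤n) (s≤s z≤n))) (zip-check⁺ xs ys (λ i<ly i<lx → lt (s≤s i<ly) (s≤s i<lx)))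

strictShifted⁻ : ∀ α β → T (strictShifted α β) → StrictShifted α β
strictShifted⁻ α β t =
  let tl , tz = ∧⁻ (length β <ᵇ length α) t ; lβ<lα = <ᵇ⇒< _ _ tl in
  lβ<lα , λ {i} i<lβ →
    subst (at β i <_) (at-drop 1 α i)
      (zip-check⁻ (drop 1 α) β tz i<lβ (subst (i <_) (sym (length-drop 1 α)) (≤-trans i<lβ (<⇒≤∸1 lβ<lα))))
  where
  <⇒≤∸1 : ∀ {a b} → suc a ≤ b → a ≤ b ∸ 1
  <⇒≤∸1 {b = suc b} (s≤s a≤b) = a≤b

strictShifted⁺ : ∀ α β → StrictShifted α β → T (strictShifted α β)
strictShifted⁺ α β (lβ<lα , shifted) =
  ∧⁺ (<⇒<ᵇ lβ<lα) (zip-check⁺ (drop 1 α) β (λ {i} i<lβ _ → subst (at β i <_) (sym (at-drop 1 α i)) (shifted i<lβ)))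

record Link (D : ℕ) (α β α′ β′ : Partition) (m : ℕ) : Set where
  field
    α-nonempty : 0 < length α
    boundedα   : All (_≤ D) α
    boundedβ   : All (_≤ D) β
    β₁≤α₁      : largest β ≤ largest α
    aboveα     : All (largest α ≤_) α′
    aboveβ     : All (largest α ≤_) β′
    shifted    : StrictShifted α β
    ranked     : length α ≡ suc m + length β

record Last (D : ℕ) (α β : Partition) (m : ℕ) : Set where
  field
    boundedα : All (_≤ D) α
    boundedβ : All (_≤ D) β
    ranked   : length α ≡ m + length β

data Symbol (D : ℕ) : List (Partition × Partition) → List ℕ → Set where
  last : ∀ {α β m} → Last D α β m → Symbol D ((α , β) ∷ []) (m ∷ [])
  link : ∀ {α β α′ β′ ps m ms} → Link D α β α′ β′ m → Symbol D ((α′ , β′) ∷ ps) ms →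
         Symbol D ((α , β) ∷ (α′ , β′) ∷ ps) (m ∷ ms)

private
  ≤ᵇ-all⁻ : ∀ D xs → T (all (_≤ᵇ D) xs) → All (_≤ D) xs
  ≤ᵇ-all⁻ D = all⁻ (_≤ᵇ D) (≤ᵇ⇒≤ _ D)

  ≤ᵇ-all⁺ : ∀ D {xs} → All (_≤ D) xs → T (all (_≤ᵇ D) xs)
  ≤ᵇ-all⁺ D = all⁺ (_≤ᵇ D) ≤⇒≤ᵇ

  ≥ᵇ-all⁻ : ∀ v xs → T (all (v ≤ᵇ_) xs) → All (v ≤_) xs
  ≥ᵇ-all⁻ v = all⁻ (v ≤ᵇ_) (≤ᵇ⇒≤ v _)

  ≥ᵇ-all⁺ : ∀ v {xs} → All (v ≤_) xs → T (all (v ≤ᵇ_) xs)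
  ≥ᵇ-all⁺ v = all⁺ (v ≤ᵇ_) ≤⇒≤ᵇ

symbolOK⁻ : ∀ D ps ms → T (symbolOK D ps ms) → Symbol D ps ms
symbolOK⁻ D ((α , β) ∷ []) (m ∷ []) t =
  let t₁ , t′ = ∧⁻ (all (_≤ᵇ D) α) t ; t₂ , t₃ = ∧⁻ (all (_≤ᵇ D) β) t′ in
  last record { boundedα = ≤ᵇ-all⁻ D α t₁ ; boundedβ = ≤ᵇ-all⁻ D β t₂ ; ranked = rank⁻ _ _ m t₃ }
symbolOK⁻ D ((α , β) ∷ (α′ , β′) ∷ ps) (m ∷ ms) t =
  let t₁ , u₁ = ∧⁻ (nonempty α) t
      t₂ , u₂ = ∧⁻ (all (_≤ᵇ D) α) u₁
      t₃ , u₃ = ∧⁻ (all (_≤ᵇ D) β) u₂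
      t₄ , u₄ = ∧⁻ (largest β ≤ᵇ largest α) u₃
      t₅ , u₅ = ∧⁻ (all (largest α ≤ᵇ_) α′) u₄
      t₆ , u₆ = ∧⁻ (all (largest α ≤ᵇ_) β′) u₅
      t₇ , u₇ = ∧⁻ (strictShifted α β) u₆
      t₈ , u₈ = ∧⁻ ⌊ (ℤ.+ length α ℤ.- ℤ.+ length β ℤ.- ℤ.1ℤ) ℤ.≟ ℤ.+ m ⌋ u₇
  in link record
       { α-nonempty = nonempty⁻ α t₁ ; boundedα = ≤ᵇ-all⁻ D α t₂ ; boundedβ = ≤ᵇ-all⁻ D β t₃
       ; β₁≤α₁ = ≤ᵇ⇒≤ _ _ t₄ ; aboveα = ≥ᵇ-all⁻ _ α′ t₅ ; aboveβ = ≥ᵇ-all⁻ _ β′ t₆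
       ; shifted = strictShifted⁻ α β t₇ ; ranked = rank1⁻ _ _ m t₈ }
       (symbolOK⁻ D ((α′ , β′) ∷ ps) ms u₈)
  where
  nonempty⁻ : ∀ xs → T (nonempty xs) → 0 < length xs
  nonempty⁻ (_ ∷ _) _ = s≤s z≤n

symbolOK⁺ : ∀ {D ps ms} → Symbol D ps ms → T (symbolOK D ps ms)
symbolOK⁺ (last L) = ∧⁺ (≤ᵇ-all⁺ _ boundedα) (∧⁺ (≤ᵇ-all⁺ _ boundedβ) (⇒rank _ _ _ ranked))
  where open Last L
symbolOK⁺ (link {α = α} {β} L S) =
  ∧⁺ (nonempty⁺ α α-nonempty) (∧⁺ (≤ᵇ-all⁺ _ boundedα) (∧⁺ (≤ᵇ-all⁺ _ boundedβ) (∧⁺ (≤⇒≤ᵇ β₁≤α₁)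
    (∧⁺ (≥ᵇ-all⁺ _ aboveα) (∧⁺ (≥ᵇ-all⁺ _ aboveβ) (∧⁺ (strictShifted⁺ α β shifted)
    (∧⁺ (⇒rank1 _ _ _ ranked) (symbolOK⁺ S))))))))
  where
  open Link L
  nonempty⁺ : ∀ xs → 0 < length xs → T (nonempty xs)
  nonempty⁺ (_ ∷ _) _ = _

ShiftedAt : List ℕ → List ℕ → ℕ → Set
ShiftedAt x β i = at β i < at x (suc i)

record IsSplitPoint (x β : List ℕ) (s : ℕ) : Set where
  field
    within        : s ≤ length β
    shifted-after : ∀ {i} → s ≤ i → i < length β → ShiftedAt x β i
    fails-before  : ∀ {s′} → s ≡ suc s′ → at x (suc s′) ≤ at β s′

-- A later split point fails where an earlier one requires the shift.
split-point-not-later : ∀ {x β s t} → IsSplitPoint x β s → IsSplitPoint x β t → s < t → ⊥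
split-point-not-later {t = suc t′} S T (s≤s s≤t′) =
  <⇒≱ (IsSplitPoint.shifted-after S s≤t′ (IsSplitPoint.within T)) (IsSplitPoint.fails-before T refl)

split-point-unique : ∀ {x β s t} → IsSplitPoint x β s → IsSplitPoint x β t → s ≡ t
split-point-unique {s = s} {t} S T with <-cmp s t
... | tri< s<t _ _ = ⊥-elim (split-point-not-later S T s<t)
... | tri≈ _ s≡t _ = s≡t
... | tri> _ _ t<s = ⊥-elim (split-point-not-later T S t<s)

-- The split point, computed from the end of β.
private
  extend : ℕ → ℕ → ℕ → ℕ
  extend b x₁ (suc s) = suc (suc s)
  extend b x₁ zero    = if b <ᵇ x₁ then 0 else 1

splitPoint : List ℕ → List ℕ → ℕ
splitPoint (_ ∷ x₁ ∷ xs) (b ∷ bs) = extend b x₁ (splitPoint (x₁ ∷ xs) bs)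
splitPoint _             _        = 0

private
  extend-spec : ∀ x₀ x₁ xs b bs s → IsSplitPoint (x₁ ∷ xs) bs s →
    IsSplitPoint (x₀ ∷ x₁ ∷ xs) (b ∷ bs) (extend b x₁ s)
  extend-spec x₀ x₁ xs b bs (suc s) S = record
    { within        = s≤s within
    ; shifted-after = λ { {suc i} (s≤s s≤i) (s≤s i<l) → shifted-after s≤i i<l }
    ; fails-before  = λ { {suc s′} refl → fails-before refl } }
    where open IsSplitPoint S
  extend-spec x₀ x₁ xs b bs zero S with b <ᵇ x₁ in b<ᵇx₁
  ... | true = record
    { within        = z≤n
    ; shifted-after = λ { {zero} _ _ → <ᵇ⇒< b x₁ (subst T (sym b<ᵇx₁) _)
                        ; {suc i} _ (s≤s i<l) → IsSplitPoint.shifted-after S z≤n i<l }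
    ; fails-before  = λ () }
  ... | false = record
    { within        = s≤s z≤n
    ; shifted-after = λ { {suc i} _ (s≤s i<l) → IsSplitPoint.shifted-after S z≤n i<l }
    ; fails-before  = λ { {zero} refl → ≮⇒≥ (λ b<x₁ → subst T b<ᵇx₁ (<⇒<ᵇ b<x₁)) } }

  split-at-end : ∀ {x} → IsSplitPoint x [] 0
  split-at-end = record { within = z≤n ; shifted-after = λ _ () ; fails-before = λ () }

splitPoint-spec : ∀ x β → length β < length x → IsSplitPoint x β (splitPoint x β)
splitPoint-spec []             []       _ = split-at-end
splitPoint-spec (x₀ ∷ [])      []       _ = split-at-end
splitPoint-spec (x₀ ∷ x₁ ∷ xs) []       _ = split-at-end
splitPoint-spec (x₀ ∷ [])      (b ∷ bs) (s≤s ())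
splitPoint-spec (x₀ ∷ x₁ ∷ xs) (b ∷ bs) (s≤s lβ<lx) =
  extend-spec x₀ x₁ xs b bs _ (splitPoint-spec (x₁ ∷ xs) bs lβ<lx)

take-++ : ∀ {A : Set} (xs ys : List A) {k} → k ≡ length xs → take k (xs ++ ys) ≡ xs
take-++ []       ys refl = refl
take-++ (x ∷ xs) ys refl = cong (x ∷_) (take-++ xs ys refl)

drop-++ : ∀ {A : Set} (xs ys : List A) {k} → k ≡ length xs → drop k (xs ++ ys) ≡ ys
drop-++ []       ys refl = refl
drop-++ (x ∷ xs) ys refl = drop-++ xs ys refl

largest-++ : ∀ xs ys → 0 < length xs → largest (xs ++ ys) ≡ largest xs
largest-++ (x ∷ xs) ys _ = refl

largest-take : ∀ k xs → largest (take (suc k) xs) ≡ largest xs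
largest-take k []      = refl
largest-take k (_ ∷ _) = refl

Pair : Set
Pair = Partition × Partition

+-interchange : ∀ a b c e → (a + b) + (c + e) ≡ (a + c) + (b + e)
+-interchange = solve-∀

+-suc-shuffle : ∀ a b c → suc (a + b) + suc c ≡ suc a + suc (b + c)
+-suc-shuffle = solve-∀

+-comm-middle : ∀ a b c → a + (b + c) ≡ b + (a + c)
+-comm-middle = solve-∀

merge : Pair → Pair → Pair
merge (α¹ , β¹) (α² , β²) = α² ++ α¹ , β² ++ β¹

cut : ℕ → ℕ → Pair → Pair × Pair
cut d s (α , β) = (drop (d + s) α , drop s β) , (take (d + s) α , take s β)

-- The inverse of merging when the first pair has rank c − 1: the heads have
-- d = l(α) − l(β) − c more parts in α than in β, and β is cut at the split
-- point of (α_{≥d}, β).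
unmerge : ℕ → Pair → Pair × Pair
unmerge c (α , β) = let d = length α ∸ (length β + c) in cut d (splitPoint (drop d α) β) (α , β)

unmerge-cut : ∀ c α β {d s} → length α ∸ (length β + c) ≡ d → splitPoint (drop d α) β ≡ s →
  unmerge c (α , β) ≡ cut d s (α , β)
unmerge-cut c α β refl refl = refl

excess : ∀ d c l → ((d + c) + l) ∸ (l + c) ≡ d
excess d c l = trans (cong (_∸ (l + c)) (trans (+-assoc d c l) (cong (d +_) (+-comm c l)))) (m+n∸n≡m d (l + c))

module Merged {D m₁ : ℕ} {α¹ β¹ α² β² : Partition}
  (pα¹ : IsPartition α¹) (pβ¹ : IsPartition β¹) (pα² : IsPartition α²) (pβ² : IsPartition β²)
  (L : Link D α¹ β¹ α² β² m₁) where

  open Link L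

  α β : Partition
  α = α² ++ α¹
  β = β² ++ β¹

  s : ℕ
  s = length β²

  α¹≤α² : ∀ {i} → i < length α² → at α¹ 0 ≤ at α² i
  α¹≤α² i<l = subst (_≤ _) (at-0 α¹) (All-at aboveα i<l)

  α¹≤β² : ∀ {i} → i < length β² → at α¹ 0 ≤ at β² i
  α¹≤β² i<l = subst (_≤ _) (at-0 α¹) (All-at aboveβ i<l)

  partition-α : IsPartition α
  partition-α = partition-++ α² α¹ pα² pα¹ α¹≤α²

  partition-β : IsPartition β
  partition-β = partition-++ β² β¹ pβ² pβ¹ (λ i<l → ≤-trans (subst₂ _≤_ (at-0 β¹) (at-0 α¹) β₁≤α₁) (α¹≤β² i<l))

  length-β : length β ≡ s + length β¹
  length-β = length-++ β²

  module _ {d : ℕ} (lα² : length α² ≡ d + length β²) where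

    length-α : length α ≡ (d + suc m₁) + length β
    length-α = begin
      length α                         ≡⟨ length-++ α² ⟩
      length α² + length α¹            ≡⟨ cong₂ _+_ lα² ranked ⟩
      (d + s) + (suc m₁ + length β¹)   ≡⟨ +-interchange d s (suc m₁) (length β¹) ⟩
      (d + suc m₁) + (s + length β¹)   ≡⟨ cong ((d + suc m₁) +_) length-β ⟨
      (d + suc m₁) + length β          ∎
      where open ≡-Reasoning

    x : List ℕ
    x = drop d α

    length-x : length x ≡ suc m₁ + length β
    length-x = begin
      length (drop d α)                    ≡⟨ length-drop d α ⟩
      length α ∸ d                         ≡⟨ cong (_∸ d) (trans length-α (+-assoc d (suc m₁) (length β))) ⟩
      (d + (suc m₁ + length β)) ∸ d        ≡⟨ m+n∸m≡n d _ ⟩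
      suc m₁ + length β                    ∎
      where open ≡-Reasoning

    x-tail : ∀ j → at x (s + j) ≡ at α¹ j
    x-tail j = begin
      at x (s + j)              ≡⟨ at-drop d α (s + j) ⟩
      at α (d + (s + j))        ≡⟨ cong (at α) (trans (cong (_+ j) lα²) (+-assoc d s j)) ⟨
      at α (length α² + j)      ≡⟨ at-++ʳ α² α¹ j ⟩
      at α¹ j                   ∎
      where open ≡-Reasoning

    -- s = l(β²) is the split point of (x, β): beyond it the shift is the
    -- shift of (α¹, β¹), and just before it condition (2) makes it fail.
    split-point : IsSplitPoint x β s
    split-point = record
      { within        = subst (s ≤_) (sym length-β) (m≤m+n s _)
      ; shifted-after = shifted-after
      ; fails-before  = fails-before }
      where
      shifted-after : ∀ {i} → s ≤ i → i < length β → ShiftedAt x β i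
      shifted-after s≤i i<l with j , refl ← m≤n⇒∃[o]m+o≡n s≤i =
        subst₂ _<_ (sym (at-++ʳ β² β¹ j)) (sym (trans (cong (at x) (sym (+-suc s j))) (x-tail (suc j))))
          (proj₂ shifted (+-cancelˡ-< s j (length β¹) (subst (s + j <_) length-β i<l)))
      fails-before : ∀ {s′} → s ≡ suc s′ → at x (suc s′) ≤ at β s′
      fails-before {s′} s≡1+s′ =
        subst₂ _≤_ (sym (trans (cong (at x) (trans (sym s≡1+s′) (sym (+-identityʳ s)))) (x-tail 0)))
                   (sym (at-++ˡ β² β¹ s′<s)) (α¹≤β² s′<s)
        where
        s′<s : s′ < length β²
        s′<s = subst (s′ <_) (sym s≡1+s′) (n<1+n s′)

    unmerge-merge : unmerge (suc m₁) (α , β) ≡ ((α¹ , β¹) , (α² , β²))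
    unmerge-merge =
      trans (unmerge-cut (suc m₁) α β excess-recovered split-recovered)
        (cong₂ _,_ (cong₂ _,_ (drop-++ α² α¹ (sym lα²)) (drop-++ β² β¹ refl))
                   (cong₂ _,_ (take-++ α² α¹ (sym lα²)) (take-++ β² β¹ refl)))
      where
      excess-recovered : length α ∸ (length β + suc m₁) ≡ d
      excess-recovered = trans (cong (_∸ (length β + suc m₁)) length-α) (excess d (suc m₁) (length β))
      split-recovered : splitPoint x β ≡ s
      split-recovered =
        split-point-unique (splitPoint-spec x β (subst (length β <_) (sym length-x) (m<n+m _ (s≤s z≤n)))) split-point

    merged-last : Last D α² β² d → Last D α β (suc (m₁ + d))
    merged-last L₂ = record
      { boundedα = All.++⁺ (Last.boundedα L₂) boundedα
      ; boundedβ = All.++⁺ (Last.boundedβ L₂) boundedβ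
      ; ranked   = trans length-α (cong (_+ length β) (+-comm d (suc m₁))) }

    merged-link : ∀ {m₂ α′ β′} → Link D α² β² α′ β′ m₂ → d ≡ suc m₂ → Link D α β α′ β′ (suc (m₁ + m₂))
    merged-link {m₂} {α′} {β′} L₂ refl = record
      { α-nonempty = ≤-trans L₂.α-nonempty (≤-trans (m≤m+n _ _) (≤-reflexive (sym (length-++ α²))))
      ; boundedα   = All.++⁺ L₂.boundedα boundedα
      ; boundedβ   = All.++⁺ L₂.boundedβ boundedβ
      ; β₁≤α₁      = subst (largest β ≤_) (sym largest-α) (largest-β β² refl)
      ; aboveα     = subst (λ v → All (v ≤_) α′) (sym largest-α) L₂.aboveα
      ; aboveβ     = subst (λ v → All (v ≤_) β′) (sym largest-α) L₂.aboveβ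
      ; shifted    = lβ<lα , merged-shift
      ; ranked     = trans length-α (cong (_+ length β) (trans (+-comm (suc m₂) (suc m₁)) (cong suc (+-suc m₁ m₂)))) }
      where
      module L₂ = Link L₂
      largest-α : largest α ≡ largest α²
      largest-α = largest-++ α² α¹ L₂.α-nonempty
      largest-β : ∀ γ → γ ≡ β² → largest (γ ++ β¹) ≤ largest α²
      largest-β []      refl = ≤-trans β₁≤α₁ (subst₂ _≤_ (sym (at-0 α¹)) (sym (at-0 α²)) (α¹≤α² L₂.α-nonempty))
      largest-β (_ ∷ _) refl = L₂.β₁≤α₁
      lβ<lα : length β < length α
      lβ<lα = subst (length β <_) (sym length-α) (m<n+m (length β) (s≤s z≤n))
      merged-shift : ∀ {i} → i < length β → at β i < at α (suc i)
      merged-shift {i} i<l with split-index i s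
      ... | inj₁ i<s =
        subst₂ _<_ (sym (at-++ˡ β² β¹ i<s)) (sym (at-++ˡ α² α¹ 1+i<lα²)) (proj₂ L₂.shifted i<s)
        where
        1+i<lα² : suc i < length α²
        1+i<lα² = subst (suc i <_) (sym lα²) (s≤s (≤-trans i<s (m≤n+m s m₂)))
      ... | inj₂ (j , refl) =
        <-≤-trans (subst₂ _<_ (sym (at-++ʳ β² β¹ j)) (sym (at-++ʳ α² α¹ (suc j))) (proj₂ shifted j<lβ¹))
                  (nonincreasing-mono α (proj₁ partition-α) 1+s+j≤lα²+1+j)
        where
        j<lβ¹ : j < length β¹
        j<lβ¹ = +-cancelˡ-< s j (length β¹) (subst (s + j <_) length-β i<l)
        1+s+j≤lα²+1+j : suc (s + j) ≤ length α² + suc j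
        1+s+j≤lα²+1+j = subst (suc (s + j) ≤_) (sym (trans (cong (_+ suc j) lα²) (+-suc-shuffle m₂ s j)))
                          (m≤n+m (suc (s + j)) (suc m₂))

module Unmerged {D m₁ d : ℕ} {α β : Partition} (pα : IsPartition α) (pβ : IsPartition β)
  (boundedα : All (_≤ D) α) (boundedβ : All (_≤ D) β)
  (lα : length α ≡ (d + suc m₁) + length β) where

  x : List ℕ
  x = drop d α

  length-x : length x ≡ suc m₁ + length β
  length-x = begin
    length (drop d α)                    ≡⟨ length-drop d α ⟩
    length α ∸ d                         ≡⟨ cong (_∸ d) (trans lα (+-assoc d (suc m₁) (length β))) ⟩
    (d + (suc m₁ + length β)) ∸ d        ≡⟨ m+n∸m≡n d _ ⟩
    suc m₁ + length β                    ∎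
    where open ≡-Reasoning

  s : ℕ
  s = splitPoint x β

  S : IsSplitPoint x β s
  S = splitPoint-spec x β (subst (length β <_) (sym length-x) (m<n+m (length β) (s≤s z≤n)))
  open IsSplitPoint S

  α¹ β¹ α² β² : Partition
  α¹ = drop (d + s) α
  β¹ = drop s β
  α² = take (d + s) α
  β² = take s β

  unmerge-cuts : unmerge (suc m₁) (α , β) ≡ ((α¹ , β¹) , (α² , β²))
  unmerge-cuts = unmerge-cut (suc m₁) α β (trans (cong (_∸ (length β + suc m₁)) lα) (excess d (suc m₁) (length β))) refl

  merge-cuts : merge (α¹ , β¹) (α² , β²) ≡ (α , β)
  merge-cuts = cong₂ _,_ (take++drop≡id (d + s) α) (take++drop≡id s β)

  t : ℕ
  t = length β ∸ s

  lβ≡s+t : length β ≡ s + t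
  lβ≡s+t = sym (m+[n∸m]≡n within)

  length-α¹ : length α¹ ≡ suc m₁ + t
  length-α¹ = begin
    length (drop (d + s) α)                 ≡⟨ length-drop (d + s) α ⟩
    length α ∸ (d + s)                      ≡⟨ cong (_∸ (d + s)) (trans lα (cong ((d + suc m₁) +_) lβ≡s+t)) ⟩
    ((d + suc m₁) + (s + t)) ∸ (d + s)      ≡⟨ cong (_∸ (d + s)) (+-interchange d (suc m₁) s t) ⟩
    ((d + s) + (suc m₁ + t)) ∸ (d + s)      ≡⟨ m+n∸m≡n (d + s) _ ⟩
    suc m₁ + t                              ∎
    where open ≡-Reasoning

  length-β¹ : length β¹ ≡ t
  length-β¹ = length-drop s β

  length-α² : length α² ≡ d + s
  length-α² = trans (length-take (d + s) α) (m≤n⇒m⊓n≡m d+s≤lα)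
    where
    d+s≤lα : d + s ≤ length α
    d+s≤lα = subst (d + s ≤_) (sym (trans lα (cong ((d + suc m₁) +_) lβ≡s+t)))
               (subst (d + s ≤_) (sym (+-interchange d (suc m₁) s t)) (m≤m+n (d + s) (suc m₁ + t)))

  length-β² : length β² ≡ s
  length-β² = trans (length-take s β) (m≤n⇒m⊓n≡m within)

  heads-excess : length α² ≡ d + length β²
  heads-excess = trans length-α² (cong (d +_) (sym length-β²))

  partition-α¹ : IsPartition α¹
  partition-α¹ = partition-drop (d + s) α pα
  partition-β¹ : IsPartition β¹
  partition-β¹ = partition-drop s β pβ
  partition-α² : IsPartition α²
  partition-α² = partition-take (d + s) α pα
  partition-β² : IsPartition β²
  partition-β² = partition-take s β pβ

  bounded-α² : All (_≤ D) α²
  bounded-α² = All.take⁺ (d + s) boundedα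
  bounded-β² : All (_≤ D) β²
  bounded-β² = All.take⁺ s boundedβ

  x-tail : ∀ j → at x (s + j) ≡ at α¹ j
  x-tail j = trans (at-drop d α (s + j)) (trans (cong (at α) (sym (+-assoc d s j))) (sym (at-drop (d + s) α j)))

  decreasing-α : Nonincreasing α
  decreasing-α = proj₁ pα

  decreasing-β : Nonincreasing β
  decreasing-β = proj₁ pβ

  α¹₁≤α² : ∀ {i} → i < length α² → at α¹ 0 ≤ at α² i
  α¹₁≤α² {i} i<l =
    let i<d+s = subst (i <_) length-α² i<l in
    subst₂ _≤_ (sym (at-drop (d + s) α 0)) (sym (at-take (d + s) α i<d+s))
      (nonincreasing-mono α decreasing-α (≤-trans (<⇒≤ i<d+s) (≤-reflexive (sym (+-identityʳ (d + s))))))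

  -- Below the split point the shift fails at s − 1, so α¹₁ ≤ β_{s−1} ≤ β²ᵢ.
  α¹₁≤β² : ∀ {i} → i < length β² → at α¹ 0 ≤ at β² i
  α¹₁≤β² {i} i<l = go s refl (subst (i <_) length-β² i<l)
    where
    go : ∀ s₀ → s₀ ≡ s → i < s₀ → at α¹ 0 ≤ at β² i
    go (suc s′) s≡ (s≤s i≤s′) =
      subst₂ _≤_ (trans (cong (at x) (trans s≡ (sym (+-identityʳ s)))) (x-tail 0))
                 (sym (at-take s β (subst (i <_) s≡ (s≤s i≤s′))))
        (≤-trans (fails-before (sym s≡)) (nonincreasing-mono β decreasing-β i≤s′))

  -- Beyond the split point the shift holds, so (α¹, β¹) is strict shifted.
  tails-shifted : ∀ {j} → j < length β¹ → at β¹ j < at α¹ (suc j)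
  tails-shifted {j} j<l =
    subst₂ _<_ (sym (at-drop s β j)) (trans (cong (at x) (sym (+-suc s j))) (x-tail (suc j)))
      (shifted-after (m≤m+n s j) (subst (s + j <_) (sym lβ≡s+t) (+-monoʳ-< s (subst (j <_) length-β¹ j<l))))

  β¹₁≤α¹₁ : at β¹ 0 ≤ at α¹ 0
  β¹₁≤α¹₁ with t in t≡
  ... | zero   = ≤-trans (≤-reflexive (at-beyond β¹ (≤-reflexive (trans length-β¹ t≡)))) z≤n
  ... | suc _  = <⇒≤ (<-≤-trans (tails-shifted (subst (0 <_) (sym (trans length-β¹ t≡)) (s≤s z≤n)))
                                (nonincreasing-mono α¹ (proj₁ partition-α¹) (n≤1+n 0)))

  tails-link : Link D α¹ β¹ α² β² m₁
  tails-link = record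
    { α-nonempty = subst (0 <_) (sym length-α¹) (s≤s z≤n)
    ; boundedα   = All.drop⁺ (d + s) boundedα
    ; boundedβ   = All.drop⁺ s boundedβ
    ; β₁≤α₁      = subst₂ _≤_ (sym (at-0 β¹)) (sym (at-0 α¹)) β¹₁≤α¹₁
    ; aboveα     = at-All α² (λ {i} i<l → subst (_≤ at α² i) (sym (at-0 α¹)) (α¹₁≤α² i<l))
    ; aboveβ     = at-All β² (λ {i} i<l → subst (_≤ at β² i) (sym (at-0 α¹)) (α¹₁≤β² i<l))
    ; shifted    = subst₂ _<_ (sym length-β¹) (sym length-α¹) (m<n+m t (s≤s z≤n)) , tails-shifted
    ; ranked     = trans length-α¹ (cong (suc m₁ +_) (sym length-β¹)) }

  heads-link : ∀ {m₂ α′ β′} → Link D α β α′ β′ (suc (m₁ + m₂)) → d ≡ suc m₂ → Link D α² β² α′ β′ m₂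
  heads-link {m₂} {α′} {β′} L refl = record
    { α-nonempty = α²-nonempty
    ; boundedα   = bounded-α²
    ; boundedβ   = bounded-β²
    ; β₁≤α₁      = subst (largest β² ≤_) (sym largest-α²) (largest-β² s refl)
    ; aboveα     = subst (λ v → All (v ≤_) α′) (sym largest-α²) L.aboveα
    ; aboveβ     = subst (λ v → All (v ≤_) β′) (sym largest-α²) L.aboveβ
    ; shifted    = subst₂ _<_ (sym length-β²) (sym length-α²) (m<n+m s (s≤s z≤n)) , heads-shifted
    ; ranked     = trans length-α² (cong (suc m₂ +_) (sym length-β²)) }
    where
    module L = Link L
    α²-nonempty : 0 < length α²
    α²-nonempty = subst (0 <_) (sym length-α²) (s≤s z≤n)
    largest-α² : largest α² ≡ largest α
    largest-α² = trans (at-0 α²) (trans (at-take (d + s) α (subst (0 <_) length-α² α²-nonempty)) (sym (at-0 α)))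
    largest-β² : ∀ s₀ → s₀ ≡ s → largest β² ≤ largest α
    largest-β² zero     s≡ = subst (λ z → largest (take z β) ≤ largest α) s≡ z≤n
    largest-β² (suc s′) s≡ = subst (λ z → largest (take z β) ≤ largest α) s≡
                               (subst (_≤ largest α) (sym (largest-take s′ β)) L.β₁≤α₁)
    heads-shifted : ∀ {i} → i < length β² → at β² i < at α² (suc i)
    heads-shifted {i} i<l =
      let i<s = subst (i <_) length-β² i<l in
      subst₂ _<_ (sym (at-take s β i<s))
        (sym (at-take (d + s) α (s≤s (≤-trans i<s (m≤n+m s m₂)))))
        (proj₂ L.shifted (<-≤-trans i<s within))

IsPartitionPair : Pair → Set
IsPartitionPair (α , β) = IsPartition α × IsPartition β

private
  rank-shuffle : ∀ m₁ m₂ → suc (m₁ + m₂) ≡ m₂ + suc m₁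
  rank-shuffle m₁ m₂ = trans (cong suc (+-comm m₁ m₂)) (sym (+-suc m₂ m₁))

merge-symbol : ∀ {D m₁ m₂ R M} p₁ p₂ → IsPartitionPair p₁ → IsPartitionPair p₂ →
  Symbol D (p₁ ∷ p₂ ∷ R) (m₁ ∷ m₂ ∷ M) →
  Symbol D (merge p₁ p₂ ∷ R) (suc (m₁ + m₂) ∷ M) × unmerge (suc m₁) (merge p₁ p₂) ≡ (p₁ , p₂) ×
  IsPartitionPair (merge p₁ p₂)
merge-symbol _ _ (pα¹ , pβ¹) (pα² , pβ²) (link L (last L₂)) =
  last (M.merged-last (Last.ranked L₂) L₂) , M.unmerge-merge (Last.ranked L₂) , M.partition-α , M.partition-β
  where module M = Merged pα¹ pβ¹ pα² pβ² L
merge-symbol _ _ (pα¹ , pβ¹) (pα² , pβ²) (link L (link L₂ S)) =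
  link (M.merged-link (Link.ranked L₂) L₂ refl) S , M.unmerge-merge (Link.ranked L₂) , M.partition-α , M.partition-β
  where module M = Merged pα¹ pβ¹ pα² pβ² L

record Unmerging (D m₁ m₂ : ℕ) (p : Pair) (R : List Pair) (M : List ℕ) : Set where
  field
    tails heads : Pair
    unmerged    : unmerge (suc m₁) p ≡ (tails , heads)
    remerged    : merge tails heads ≡ p
    symbol      : Symbol D (tails ∷ heads ∷ R) (m₁ ∷ m₂ ∷ M)
    partitions  : IsPartitionPair tails × IsPartitionPair heads

unmerge-symbol : ∀ {D m₁ m₂ R M} p → IsPartitionPair p → Symbol D (p ∷ R) (suc (m₁ + m₂) ∷ M) →
  Unmerging D m₁ m₂ p R M
unmerge-symbol {m₁ = m₁} {m₂} (α , β) (pα , pβ) (last L) = record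
  { unmerged   = U.unmerge-cuts
  ; remerged   = U.merge-cuts
  ; symbol     = link U.tails-link (last record
                   { boundedα = U.bounded-α² ; boundedβ = U.bounded-β² ; ranked = U.heads-excess })
  ; partitions = (U.partition-α¹ , U.partition-β¹) , (U.partition-α² , U.partition-β²) }
  where
  module U = Unmerged {d = m₂} pα pβ (Last.boundedα L) (Last.boundedβ L)
                      (trans (Last.ranked L) (cong (_+ length β) (rank-shuffle m₁ m₂)))
unmerge-symbol {m₁ = m₁} {m₂} (α , β) (pα , pβ) (link L S) = record
  { unmerged   = U.unmerge-cuts
  ; remerged   = U.merge-cuts
  ; symbol     = link U.tails-link (link (U.heads-link L refl) S)
  ; partitions = (U.partition-α¹ , U.partition-β¹) , (U.partition-α² , U.partition-β²) }
  where
  module U = Unmerged {d = suc m₂} pα pβ (Link.boundedα L) (Link.boundedβ L)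
                      (trans (Link.ranked L) (cong (λ r → suc r + length β) (rank-shuffle m₁ m₂)))

pair-weight≤ : ∀ D α β R → sumᴸ α + sumᴸ β ≤ weight D ((α , β) ∷ R)
pair-weight≤ D α β R = ≤-trans (m≤m+n _ _) (m≤m+n _ (D * D))

rest-weight≤ : ∀ D p R → weight D R ≤ weight D (p ∷ R)
rest-weight≤ D p R = +-monoˡ-≤ (D * D) (m≤n+m _ _)

merge-weight : ∀ D α¹ β¹ α² β² R → weight D (merge (α¹ , β¹) (α² , β²) ∷ R) ≡ weight D ((α¹ , β¹) ∷ (α² , β²) ∷ R)
merge-weight D α¹ β¹ α² β² R
  rewrite sum-++ α² α¹ | sum-++ β² β¹ = rearrange (sumᴸ α¹) (sumᴸ β¹) (sumᴸ α²) (sumᴸ β²) _ (D * D)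
  where
  rearrange : ∀ a b c e r q → (((c + a) + (e + b)) + r) + q ≡ ((a + b) + ((c + e) + r)) + q
  rearrange = solve-∀

isSymbol : (k : ℕ) → Vec ℕ k → ℕ → ℕ × Vec Pair k → Bool
isSymbol k ms n s = (weight (proj₁ s) (toList (proj₂ s)) ≡ᵇ n) ∧ symbolOK (proj₁ s) (toList (proj₂ s)) (toList ms)

record Counted (k : ℕ) (ms : Vec ℕ k) (n D : ℕ) (v : Vec Pair k) : Set where
  field
    D≤n    : D ≤ n
    pairs  : VecAll.All (_∈ Pairs n) v
    weighs : weight D (toList v) ≡ n
    symbol : Symbol D (toList v) (toList ms)

counted⁻ : ∀ {k ms n D v} → (D , v) ∈ candidates k n ∣ isSymbol k ms n → Counted k ms n D v
counted⁻ {k} {ms} {n} {D} {v} (Dv∈ , t) =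
  let D≤n , pairs = candidates⁻ k n Dv∈ ; tw , ts = ∧⁻ (weight D (toList v) ≡ᵇ n) t in
  record { D≤n = D≤n ; pairs = pairs ; weighs = ≡ᵇ⇒≡ _ n tw ; symbol = symbolOK⁻ D (toList v) (toList ms) ts }

counted⁺ : ∀ {k ms n D v} → Counted k ms n D v → (D , v) ∈ candidates k n ∣ isSymbol k ms n
counted⁺ {k} {n = n} C = candidates⁺ k n D≤n pairs , ∧⁺ (≡⇒≡ᵇ _ n weighs) (symbolOK⁺ symbol)
  where open Counted C

merge-count : ∀ k m₁ m₂ (ms : Vec ℕ k) n →
  Dss (suc (suc k)) (m₁ ∷ m₂ ∷ ms) n ≡ Dss (suc k) (suc (m₁ + m₂) ∷ ms) n
merge-count k m₁ m₂ ms n =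
  count-by-correspondence (isSymbol _ ms₂ n) (isSymbol _ ms₁ n) (candidates-unique _ n) (candidates-unique _ n)
    record { to = to ; from = from ; to-ok = to-ok ; from-ok = from-ok ; from∘to = from∘to ; to∘from = to∘from }
  where
  ms₂ : Vec ℕ (suc (suc k))
  ms₂ = m₁ ∷ m₂ ∷ ms

  ms₁ : Vec ℕ (suc k)
  ms₁ = suc (m₁ + m₂) ∷ ms

  to : ℕ × Vec Pair (suc (suc k)) → ℕ × Vec Pair (suc k)
  to (D , p₁ ∷ p₂ ∷ v) = D , merge p₁ p₂ ∷ v

  from : ℕ × Vec Pair (suc k) → ℕ × Vec Pair (suc (suc k))
  from (D , p ∷ v) = D , proj₁ (unmerge (suc m₁) p) ∷ proj₂ (unmerge (suc m₁) p) ∷ v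

  module Merging {D p₁ p₂ v} (selected : (D , p₁ ∷ p₂ ∷ v) ∈ candidates _ n ∣ isSymbol _ ms₂ n) where
    open Counted (counted⁻ {ms = ms₂} selected) public
    merged : Symbol D (merge p₁ p₂ ∷ toList v) (toList ms₁) × unmerge (suc m₁) (merge p₁ p₂) ≡ (p₁ , p₂) ×
             IsPartitionPair (merge p₁ p₂)
    merged = merge-symbol p₁ p₂ (pairs⁻ n (VecAll.head pairs)) (pairs⁻ n (VecAll.head (VecAll.tail pairs))) symbol
    weighs′ : weight D (merge p₁ p₂ ∷ toList v) ≡ n
    weighs′ = trans (merge-weight D (proj₁ p₁) (proj₂ p₁) (proj₁ p₂) (proj₂ p₂) (toList v)) weighs

  module Splitting {D p v} (selected : (D , p ∷ v) ∈ candidates _ n ∣ isSymbol _ ms₁ n) where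
    open Counted (counted⁻ {ms = ms₁} selected) public
    open Unmerging (unmerge-symbol {m₁ = m₁} {m₂} p (pairs⁻ n (VecAll.head pairs)) symbol)
      public renaming (symbol to split-symbol)
    weighs′ : weight D (tails ∷ heads ∷ toList v) ≡ n
    weighs′ = trans (sym (merge-weight D (proj₁ tails) (proj₂ tails) (proj₁ heads) (proj₂ heads) (toList v)))
                    (trans (cong (λ q → weight D (q ∷ toList v)) remerged) weighs)

  to-ok : ∀ {x} → x ∈ candidates _ n ∣ isSymbol _ ms₂ n → to x ∈ candidates _ n ∣ isSymbol _ ms₁ n
  to-ok {D , p₁ ∷ p₂ ∷ v} selected = counted⁺ {ms = ms₁} record
    { D≤n    = D≤n
    ; pairs  = pairs⁺ n (proj₁ (proj₂ (proj₂ merged))) (proj₂ (proj₂ (proj₂ merged)))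
                 (≤-trans (pair-weight≤ D (proj₁ (merge p₁ p₂)) (proj₂ (merge p₁ p₂)) (toList v)) (≤-reflexive weighs′))
               VecAll.∷ VecAll.tail (VecAll.tail pairs)
    ; weighs = weighs′
    ; symbol = proj₁ merged }
    where open Merging selected

  from-ok : ∀ {y} → y ∈ candidates _ n ∣ isSymbol _ ms₁ n → from y ∈ candidates _ n ∣ isSymbol _ ms₂ n
  from-ok {D , p ∷ v} selected =
    subst (λ q → (D , proj₁ q ∷ proj₂ q ∷ v) ∈ candidates _ n ∣ isSymbol _ ms₂ n) (sym unmerged) (counted⁺ {ms = ms₂} record
      { D≤n    = D≤n
      ; pairs  = pairs⁺ n (proj₁ (proj₁ partitions)) (proj₂ (proj₁ partitions))
                   (≤-trans (pair-weight≤ D (proj₁ tails) (proj₂ tails) (heads ∷ toList v)) (≤-reflexive weighs′))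
                 VecAll.∷ pairs⁺ n (proj₁ (proj₂ partitions)) (proj₂ (proj₂ partitions))
                   (≤-trans (pair-weight≤ D (proj₁ heads) (proj₂ heads) (toList v))
                     (≤-trans (rest-weight≤ D tails (heads ∷ toList v)) (≤-reflexive weighs′)))
                 VecAll.∷ VecAll.tail pairs
      ; weighs = weighs′
      ; symbol = split-symbol })
    where open Splitting selected

  from∘to : ∀ {x} → x ∈ candidates _ n ∣ isSymbol _ ms₂ n → from (to x) ≡ x
  from∘to {D , p₁ ∷ p₂ ∷ v} selected =
    cong (λ q → D , proj₁ q ∷ proj₂ q ∷ v) (proj₁ (proj₂ (Merging.merged selected)))

  to∘from : ∀ {y} → y ∈ candidates _ n ∣ isSymbol _ ms₁ n → to (from y) ≡ y
  to∘from {D , p ∷ v} selected =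
    trans (cong (λ q → D , merge (proj₁ q) (proj₂ q) ∷ v) unmerged) (cong (λ q → D , q ∷ v) remerged)
    where open Splitting selected

addColumn : ℕ → List ℕ → List ℕ
addColumn zero    ys       = ys
addColumn (suc x) []       = 1 ∷ addColumn x []
addColumn (suc x) (y ∷ ys) = suc y ∷ addColumn x ys

-- The conjugate partition, built column by column.  It ignores parts 0.
conjugate : List ℕ → List ℕ
conjugate []       = []
conjugate (x ∷ xs) = addColumn x (conjugate xs)

consPositive : ℕ → List ℕ → List ℕ
consPositive zero    ys = ys
consPositive (suc x) ys = suc x ∷ ys

dropZeros : List ℕ → List ℕ
dropZeros []       = []
dropZeros (x ∷ xs) = consPositive x (dropZeros xs)

pad : ℕ → List ℕ → List ℕ
pad D γ = γ ++ replicate (D ∸ length γ) 0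

at-addColumn-< : ∀ x ys {i} → i < x → at (addColumn x ys) i ≡ suc (at ys i)
at-addColumn-< (suc x) []       {zero}  _         = refl
at-addColumn-< (suc x) []       {suc i} (s≤s i<x) = at-addColumn-< x [] i<x
at-addColumn-< (suc x) (y ∷ ys) {zero}  _         = refl
at-addColumn-< (suc x) (y ∷ ys) {suc i} (s≤s i<x) = at-addColumn-< x ys i<x

at-addColumn-≥ : ∀ x ys {i} → x ≤ i → at (addColumn x ys) i ≡ at ys i
at-addColumn-≥ zero    ys       _         = refl
at-addColumn-≥ (suc x) []       (s≤s x≤i) = at-addColumn-≥ x [] x≤i
at-addColumn-≥ (suc x) (y ∷ ys) (s≤s x≤i) = at-addColumn-≥ x ys x≤i

nonincreasing-addColumn : ∀ x ys → Nonincreasing ys → Nonincreasing (addColumn x ys)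
nonincreasing-addColumn x ys dec i with split-index (suc i) x | split-index i x
... | inj₁ 1+i<x | _ =
  subst₂ _≤_ (sym (at-addColumn-< x ys 1+i<x)) (sym (at-addColumn-< x ys (<-trans (n<1+n i) 1+i<x))) (s≤s (dec i))
... | inj₂ (j , e) | inj₁ i<x =
  subst₂ _≤_ (sym (at-addColumn-≥ x ys (subst (x ≤_) (sym e) (m≤m+n x j)))) (sym (at-addColumn-< x ys i<x))
    (≤-trans (dec i) (n≤1+n _))
... | inj₂ (j , e) | inj₂ (j′ , e′) =
  subst₂ _≤_ (sym (at-addColumn-≥ x ys (subst (x ≤_) (sym e) (m≤m+n x j))))
             (sym (at-addColumn-≥ x ys (subst (x ≤_) (sym e′) (m≤m+n x j′)))) (dec i)

positive-addColumn : ∀ x ys → All (0 <_) ys → All (0 <_) (addColumn x ys)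
positive-addColumn zero    ys       pos       = pos
positive-addColumn (suc x) []       pos       = s≤s z≤n ∷ positive-addColumn x [] []
positive-addColumn (suc x) (y ∷ ys) (_ ∷ pos) = s≤s z≤n ∷ positive-addColumn x ys pos

sum-addColumn : ∀ x ys → sumᴸ (addColumn x ys) ≡ x + sumᴸ ys
sum-addColumn zero    ys       = refl
sum-addColumn (suc x) []       = cong suc (sum-addColumn x [])
sum-addColumn (suc x) (y ∷ ys) = cong suc (begin
  y + sumᴸ (addColumn x ys)   ≡⟨ cong (y +_) (sum-addColumn x ys) ⟩
  y + (x + sumᴸ ys)           ≡⟨ +-assoc y x (sumᴸ ys) ⟨
  (y + x) + sumᴸ ys           ≡⟨ cong (_+ sumᴸ ys) (+-comm y x) ⟩
  (x + y) + sumᴸ ys           ≡⟨ +-assoc x y (sumᴸ ys) ⟩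
  x + (y + sumᴸ ys)           ∎)
  where open ≡-Reasoning

length-addColumn : ∀ x ys → length (addColumn x ys) ≡ x ⊔ length ys
length-addColumn zero    ys       = refl
length-addColumn (suc x) []       = cong suc (trans (length-addColumn x []) (⊔-identityʳ x))
length-addColumn (suc x) (y ∷ ys) = cong suc (length-addColumn x ys)

largest-addColumn : ∀ x ys → largest (addColumn (suc x) ys) ≡ suc (largest ys)
largest-addColumn x []      = refl
largest-addColumn x (_ ∷ _) = refl

largest-addColumn≤ : ∀ x ys → largest (addColumn x ys) ≤ suc (largest ys)
largest-addColumn≤ zero    []      = z≤n
largest-addColumn≤ zero    (y ∷ _) = n≤1+n y
largest-addColumn≤ (suc x) ys      = ≤-reflexive (largest-addColumn x ys)

partition-conjugate : ∀ γ → IsPartition (conjugate γ)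
partition-conjugate γ = decreasing γ , positive γ
  where
  decreasing : ∀ γ → Nonincreasing (conjugate γ)
  decreasing []       i = z≤n
  decreasing (x ∷ xs)   = nonincreasing-addColumn x (conjugate xs) (decreasing xs)
  positive : ∀ γ → All (0 <_) (conjugate γ)
  positive []       = []
  positive (x ∷ xs) = positive-addColumn x (conjugate xs) (positive xs)

sum-conjugate : ∀ γ → sumᴸ (conjugate γ) ≡ sumᴸ γ
sum-conjugate []       = refl
sum-conjugate (x ∷ xs) = trans (sum-addColumn x (conjugate xs)) (cong (x +_) (sum-conjugate xs))

length-conjugate : ∀ γ → Nonincreasing γ → length (conjugate γ) ≡ largest γ
length-conjugate []       _   = refl
length-conjugate (x ∷ xs) dec = begin
  length (addColumn x (conjugate xs))   ≡⟨ length-addColumn x (conjugate xs) ⟩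
  x ⊔ length (conjugate xs)             ≡⟨ cong (x ⊔_) (trans (length-conjugate xs (dec ∘ suc)) (at-0 xs)) ⟩
  x ⊔ at xs 0                           ≡⟨ m≥n⇒m⊔n≡m (dec 0) ⟩
  x                                     ∎
  where open ≡-Reasoning

largest-conjugate : ∀ α → All (0 <_) α → largest (conjugate α) ≡ length α
largest-conjugate []          _       = refl
largest-conjugate (suc x ∷ α) (_ ∷ pos) = trans (largest-addColumn x (conjugate α)) (cong suc (largest-conjugate α pos))

largest-conjugate≤ : ∀ γ → largest (conjugate γ) ≤ length γ
largest-conjugate≤ []       = z≤n
largest-conjugate≤ (x ∷ xs) = ≤-trans (largest-addColumn≤ x (conjugate xs)) (s≤s (largest-conjugate≤ xs))

-- Adding a column
-- of height x ≥ l(ys) increments the zero-padded ys, and conjugating a list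
-- incremented everywhere adds a first part equal to its length.
private
  conjugate-map-suc : ∀ zs → conjugate (map suc zs) ≡ consPositive (length zs) (conjugate zs)
  conjugate-map-suc []           = refl
  conjugate-map-suc (z ∷ [])     = refl
  conjugate-map-suc (z ∷ z′ ∷ zs) = cong (addColumn (suc z)) (conjugate-map-suc (z′ ∷ zs))

  conjugate-zeros : ∀ k → conjugate (replicate k 0) ≡ []
  conjugate-zeros zero    = refl
  conjugate-zeros (suc k) = conjugate-zeros k

  addColumn≡map-suc : ∀ x ys → length ys ≤ x → addColumn x ys ≡ map suc (pad x ys)
  addColumn≡map-suc zero    []       _         = refl
  addColumn≡map-suc (suc x) []       _         = cong (1 ∷_) (addColumn≡map-suc x [] z≤n)
  addColumn≡map-suc (suc x) (y ∷ ys) (s≤s l≤x) = cong (suc y ∷_) (addColumn≡map-suc x ys l≤x)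

conjugate-pad : ∀ zs k → conjugate (zs ++ replicate k 0) ≡ conjugate zs
conjugate-pad []       k = conjugate-zeros k
conjugate-pad (z ∷ zs) k = cong (addColumn z) (conjugate-pad zs k)

length-pad : ∀ zs x → length zs ≤ x → length (pad x zs) ≡ x
length-pad zs x l≤x =
  trans (length-++ zs) (trans (cong (length zs +_) (length-replicate (x ∸ length zs))) (m+[n∸m]≡n l≤x))

at-pad : ∀ xs k i → at (xs ++ replicate k 0) i ≡ at xs i
at-pad []       zero    i       = refl
at-pad []       (suc k) zero    = refl
at-pad []       (suc k) (suc i) = at-pad [] k i
at-pad (x ∷ xs) k       zero    = refl
at-pad (x ∷ xs) k       (suc i) = at-pad xs k i

conjugate-involutive : ∀ γ → Nonincreasing γ → conjugate (conjugate γ) ≡ dropZeros γ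
conjugate-involutive []       _   = refl
conjugate-involutive (x ∷ xs) dec = begin
  conjugate (addColumn x (conjugate xs))          ≡⟨ cong conjugate (addColumn≡map-suc x (conjugate xs) l≤x) ⟩
  conjugate (map suc P)                           ≡⟨ conjugate-map-suc P ⟩
  consPositive (length P) (conjugate P)           ≡⟨ cong₂ consPositive (length-pad (conjugate xs) x l≤x)
                                                                        (conjugate-pad (conjugate xs) _) ⟩
  consPositive x (conjugate (conjugate xs))       ≡⟨ cong (consPositive x) (conjugate-involutive xs (dec ∘ suc)) ⟩
  consPositive x (dropZeros xs)                   ∎
  where
  open ≡-Reasoning
  l≤x : length (conjugate xs) ≤ x
  l≤x = subst (_≤ x) (sym (trans (length-conjugate xs (dec ∘ suc)) (at-0 xs))) (dec 0)
  P : List ℕ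
  P = pad x (conjugate xs)

dropZeros-positive : ∀ α → All (0 <_) α → dropZeros α ≡ α
dropZeros-positive []          _         = refl
dropZeros-positive (suc x ∷ α) (_ ∷ pos) = cong (suc x ∷_) (dropZeros-positive α pos)

pad-dropZeros : ∀ γ → Nonincreasing γ → pad (length γ) (dropZeros γ) ≡ γ
pad-dropZeros []          _   = refl
pad-dropZeros (zero ∷ xs) dec =
  trans (cong (λ z → z ++ replicate (suc (length xs) ∸ length z) 0) (dropZeros-zeros xs zeros))
        (cong (0 ∷_) (sym zeros))
  where
  all-zero : ∀ xs → Nonincreasing (0 ∷ xs) → xs ≡ replicate (length xs) 0
  all-zero []       _   = refl
  all-zero (y ∷ xs) dec with dec 0
  ... | z≤n = cong (0 ∷_) (all-zero xs (dec ∘ suc))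
  zeros : xs ≡ replicate (length xs) 0
  zeros = all-zero xs dec
  dropZeros-zeros : ∀ xs → xs ≡ replicate (length xs) 0 → dropZeros xs ≡ []
  dropZeros-zeros []          _ = refl
  dropZeros-zeros (zero ∷ xs) e = dropZeros-zeros xs (cong (λ { [] → [] ; (_ ∷ t) → t }) e)
pad-dropZeros (suc x ∷ xs) dec = cong (suc x ∷_) (pad-dropZeros xs (dec ∘ suc))

-- durfee i π is the largest D with π_j ≥ i + j + 1 for all j < D; the
-- Durfee square of π has side durfee 0 π.
durfee : ℕ → List ℕ → ℕ
durfee i []       = 0
durfee i (x ∷ xs) = if suc i ≤ᵇ x then suc (durfee (suc i) xs) else 0

record IsDurfee (i : ℕ) (xs : List ℕ) (D : ℕ) : Set where
  field
    within : D ≤ length xs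
    square : ∀ {j} → j < D → suc (i + j) ≤ at xs j
    edge   : at xs D ≤ i + D

durfee-spec : ∀ i xs → IsDurfee i xs (durfee i xs)
durfee-spec i []       = record { within = z≤n ; square = λ () ; edge = z≤n }
durfee-spec i (x ∷ xs) with suc i ≤ᵇ x in fits
... | true  = record
  { within = s≤s within
  ; square = λ { {zero} _ → subst (_≤ x) (cong suc (sym (+-identityʳ i))) (≤ᵇ⇒≤ (suc i) x (subst T (sym fits) _))
               ; {suc j} (s≤s j<D) → subst (_≤ at xs j) (cong suc (sym (+-suc i j))) (square j<D) }
  ; edge   = subst (at xs (durfee (suc i) xs) ≤_) (sym (+-suc i _)) edge }
  where open IsDurfee (durfee-spec (suc i) xs)
... | false = record
  { within = z≤n
  ; square = λ ()
  ; edge   = subst (x ≤_) (sym (+-identityʳ i)) (≮⇒≥ (λ i<x → subst T fits (≤⇒≤ᵇ i<x))) }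

-- The side is determined: a larger square would violate the edge condition.
durfee-unique : ∀ {i xs D E} → IsDurfee i xs D → IsDurfee i xs E → D ≡ E
durfee-unique {D = D} {E} SD SE with <-cmp D E
... | tri< D<E _ _ = ⊥-elim (<⇒≱ (IsDurfee.square SE D<E) (IsDurfee.edge SD))
... | tri≈ _ D≡E _ = D≡E
... | tri> _ _ E<D = ⊥-elim (<⇒≱ (IsDurfee.square SD E<D) (IsDurfee.edge SE))

sum-map-+ : ∀ D xs → sumᴸ (map (D +_) xs) ≡ length xs * D + sumᴸ xs
sum-map-+ D []       = refl
sum-map-+ D (x ∷ xs) rewrite sum-map-+ D xs = rearrange D x (length xs) (sumᴸ xs)
  where
  rearrange : ∀ D x l s → (D + x) + (l * D + s) ≡ (D + l * D) + (x + s)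
  rearrange = solve-∀

nonincreasing-map : ∀ (f : ℕ → ℕ) → (∀ {a b} → a ≤ b → f a ≤ f b) →
  ∀ xs → Nonincreasing xs → Nonincreasing (map f xs)
nonincreasing-map f mono xs dec i with split-index (suc i) (length xs)
... | inj₁ 1+i<l =
  subst₂ _≤_ (sym (at-map f xs 1+i<l)) (sym (at-map f xs (<-trans (n<1+n i) 1+i<l))) (mono (dec i))
... | inj₂ (j , 1+i≡l+j) =
  ≤-trans (≤-reflexive (at-beyond (map f xs) (subst (_≤ suc i) (sym (length-map f xs))
                                                (subst (length xs ≤_) (sym 1+i≡l+j) (m≤m+n _ j))))) z≤n

map-+-∸ : ∀ D xs → All (D ≤_) xs → map (D +_) (map (_∸ D) xs) ≡ xs
map-+-∸ D []       []           = refl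
map-+-∸ D (x ∷ xs) (D≤x ∷ D≤xs) = cong₂ _∷_ (m+[n∸m]≡n D≤x) (map-+-∸ D xs D≤xs)

map-∸-+ : ∀ D xs → map (_∸ D) (map (D +_) xs) ≡ xs
map-∸-+ D []       = refl
map-∸-+ D (x ∷ xs) = cong₂ _∷_ (m+n∸m≡n D x) (map-∸-+ D xs)

sum-zeros : ∀ k → sumᴸ (replicate k 0) ≡ 0
sum-zeros zero    = refl
sum-zeros (suc k) = sum-zeros k

bounded-by-0 : ∀ α → All (0 <_) α → All (_≤ 0) α → α ≡ []
bounded-by-0 []      _         _         = refl
bounded-by-0 (x ∷ α) (0<x ∷ _) (x≤0 ∷ _) = ⊥-elim (<⇒≱ 0<x x≤0)

-- The partition with Durfee square of side D, columns α to the right of the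
-- square and rows β below it: its first D parts are D + α′ᵢ.
toPartition : ℕ → Pair → Partition
toPartition D (α , β) = map (D +_) (pad D (conjugate α)) ++ β

fromPartition : Partition → ℕ × Pair
fromPartition π = D , conjugate (map (_∸ D) (take D π)) , drop D π
  where D = durfee 0 π

module SymbolPartition {D m : ℕ} {α β : Partition} (pα : IsPartition α) (pβ : IsPartition β)
  (L : Last D α β m) where

  open Last L

  γ : List ℕ
  γ = conjugate α

  length-γ≤D : length γ ≤ D
  length-γ≤D = subst (_≤ D) (sym (trans (length-conjugate α (proj₁ pα)) (at-0 α))) (bounded-at α boundedα 0)

  top : List ℕ
  top = map (D +_) (pad D γ)

  length-top : length top ≡ D
  length-top = trans (length-map (D +_) (pad D γ)) (length-pad γ D length-γ≤D)

  at-top : ∀ {i} → i < D → at top i ≡ D + at γ i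
  at-top {i} i<D =
    trans (at-map (D +_) (pad D γ) (subst (i <_) (sym (length-pad γ D length-γ≤D)) i<D))
          (cong (D +_) (at-pad γ (D ∸ length γ) i))

  partition-top : IsPartition top
  partition-top =
    nonincreasing-map (D +_) (+-monoʳ-≤ D) (pad D γ)
      (λ i → subst₂ _≤_ (sym (at-pad γ _ (suc i))) (sym (at-pad γ _ i)) (proj₁ (partition-conjugate α) i)) ,
    at-All top (λ {i} i<l → let i<D = subst (i <_) length-top i<l in
                  subst (0 <_) (sym (at-top i<D)) (≤-trans (≤-trans (s≤s z≤n) i<D) (m≤m+n D _)))

  π : Partition
  π = top ++ β

  at-π-top : ∀ {i} → i < D → at π i ≡ D + at γ i
  at-π-top i<D = trans (at-++ˡ top β (subst (_ <_) (sym length-top) i<D)) (at-top i<D)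

  at-π-below : ∀ j → at π (D + j) ≡ at β j
  at-π-below j = trans (cong (λ z → at π (z + j)) (sym length-top)) (at-++ʳ top β j)

  partition-π : IsPartition π
  partition-π = partition-++ top β partition-top pβ (λ {i} i<l →
    let i<D = subst (i <_) length-top i<l in
    subst (at β 0 ≤_) (sym (at-top i<D)) (≤-trans (bounded-at β boundedβ 0) (m≤m+n D _)))

  sum-π : sumᴸ π ≡ weight D ((α , β) ∷ [])
  sum-π = begin
    sumᴸ (top ++ β)                                 ≡⟨ sum-++ top β ⟩
    sumᴸ top + sumᴸ β                               ≡⟨ cong (_+ sumᴸ β) (sum-map-+ D (pad D γ)) ⟩
    (length (pad D γ) * D + sumᴸ (pad D γ)) + sumᴸ β ≡⟨ cong₂ (λ l z → (l * D + z) + sumᴸ β)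
                                                              (length-pad γ D length-γ≤D) sum-pad ⟩
    (D * D + sumᴸ α) + sumᴸ β                       ≡⟨ rearrange D (sumᴸ α) (sumᴸ β) ⟩
    weight D ((α , β) ∷ [])                         ∎
    where
    open ≡-Reasoning
    sum-pad : sumᴸ (pad D γ) ≡ sumᴸ α
    sum-pad = trans (sum-++ γ (replicate (D ∸ length γ) 0))
                (trans (cong (sumᴸ γ +_) (sum-zeros (D ∸ length γ))) (trans (+-identityʳ _) (sum-conjugate α)))
    rearrange : ∀ D x y → (D * D + x) + y ≡ ((x + y) + 0) + D * D
    rearrange = solve-∀

  length-π : length π ≡ D + length β
  length-π = trans (length-++ top) (cong (_+ length β) length-top)

  -- π₁ = D + l(α) and l(π) = D + l(β), so π has rank l(α) − l(β) = m.
  rank-π : largest π ≡ m + length π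
  rank-π = by-side D refl
    where
    by-side : ∀ d → D ≡ d → largest π ≡ m + length π
    by-side zero D≡0 =
      let α≡[] = bounded-by-0 α (proj₂ pα) (subst (λ z → All (_≤ z) α) D≡0 boundedα)
          β≡[] = bounded-by-0 β (proj₂ pβ) (subst (λ z → All (_≤ z) β) D≡0 boundedβ)
          l≡0 : length π ≡ 0
          l≡0 = trans length-π (cong₂ _+_ D≡0 (cong length β≡[]))
          m≡0 : m ≡ 0
          m≡0 = m+n≡0⇒m≡0 m (sym (trans (cong length (sym α≡[])) (trans ranked (cong (λ z → m + length z) β≡[]))))
      in trans (at-0 π) (trans (at-beyond π (≤-reflexive l≡0)) (sym (cong₂ _+_ m≡0 l≡0)))
    by-side (suc _) D≡1+d = begin
      largest π              ≡⟨ at-0 π ⟩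
      at π 0                 ≡⟨ at-π-top (subst (0 <_) (sym D≡1+d) (s≤s z≤n)) ⟩
      D + at γ 0             ≡⟨ cong (D +_) (trans (sym (at-0 γ)) (largest-conjugate α (proj₂ pα))) ⟩
      D + length α           ≡⟨ cong (D +_) ranked ⟩
      D + (m + length β)     ≡⟨ +-comm-middle D m (length β) ⟩
      m + (D + length β)     ≡⟨ cong (m +_) length-π ⟨
      m + length π           ∎
      where open ≡-Reasoning

  durfee-π : durfee 0 π ≡ D
  durfee-π = durfee-unique (durfee-spec 0 π) record
    { within = subst (D ≤_) (sym length-π) (m≤m+n D _)
    ; square = λ {j} j<D → subst (suc j ≤_) (sym (at-π-top j<D)) (≤-trans j<D (m≤m+n D _))
    ; edge   = subst (_≤ D) (sym (trans (cong (at π) (sym (+-identityʳ D))) (at-π-below 0))) (bounded-at β boundedβ 0) }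

  from-to : fromPartition π ≡ (D , α , β)
  from-to rewrite durfee-π = cong₂ (λ α′ β′ → D , α′ , β′) columns (drop-++ top β (sym length-top))
    where
    columns : conjugate (map (_∸ D) (take D π)) ≡ α
    columns = begin
      conjugate (map (_∸ D) (take D π))     ≡⟨ cong (conjugate ∘ map (_∸ D)) (take-++ top β (sym length-top)) ⟩
      conjugate (map (_∸ D) top)            ≡⟨ cong conjugate (map-∸-+ D (pad D γ)) ⟩
      conjugate (pad D γ)                   ≡⟨ conjugate-pad γ _ ⟩
      conjugate (conjugate α)               ≡⟨ conjugate-involutive α (proj₁ pα) ⟩
      dropZeros α                           ≡⟨ dropZeros-positive α (proj₂ pα) ⟩
      α                                     ∎
      where open ≡-Reasoning

module PartitionSymbol {n m : ℕ} {π : Partition} (pπ : IsPartition π) (sum≡n : sumᴸ π ≡ n)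
  (rank≡m : largest π ≡ m + length π) where

  D : ℕ
  D = durfee 0 π

  open IsDurfee (durfee-spec 0 π)

  decreasing-π : Nonincreasing π
  decreasing-π = proj₁ pπ

  top-parts≥D : ∀ {j} → j < D → D ≤ at π j
  top-parts≥D {j} j<D = go D refl j<D
    where
    go : ∀ D₀ → D₀ ≡ D → j < D₀ → D₀ ≤ at π j
    go (suc D′) D≡ (s≤s j≤D′) = ≤-trans (square (subst (D′ <_) D≡ (n<1+n D′))) (nonincreasing-mono π decreasing-π j≤D′)

  τ : List ℕ
  τ = take D π

  length-τ : length τ ≡ D
  length-τ = trans (length-take D π) (m≤n⇒m⊓n≡m within)

  γ : List ℕ
  γ = map (_∸ D) τ

  length-γ : length γ ≡ D
  length-γ = trans (length-map (_∸ D) τ) length-τ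

  decreasing-γ : Nonincreasing γ
  decreasing-γ = nonincreasing-map (_∸ D) (∸-monoˡ-≤ D) τ (proj₁ (partition-take D π pπ))

  α β : Partition
  α = conjugate γ
  β = drop D π

  shift-back : map (D +_) γ ≡ τ
  shift-back = map-+-∸ D τ (at-All τ (λ {i} i<l → let i<D = subst (i <_) length-τ i<l in
                                          subst (D ≤_) (sym (at-take D π i<D)) (top-parts≥D i<D)))

  to-from : toPartition D (α , β) ≡ π
  to-from = begin
    map (D +_) (pad D (conjugate (conjugate γ))) ++ β    ≡⟨ cong (λ z → map (D +_) (pad D z) ++ β) (conjugate-involutive γ decreasing-γ) ⟩
    map (D +_) (pad D (dropZeros γ)) ++ β                ≡⟨ cong (λ z → map (D +_) z ++ β) padded ⟩
    map (D +_) γ ++ β                                    ≡⟨ cong (_++ β) shift-back ⟩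
    τ ++ β                                               ≡⟨ take++drop≡id D π ⟩
    π                                                    ∎
    where
    open ≡-Reasoning
    padded : pad D (dropZeros γ) ≡ γ
    padded = subst (λ l → pad l (dropZeros γ) ≡ γ) length-γ (pad-dropZeros γ decreasing-γ)

  D≤n : D ≤ n
  D≤n = ≤-trans within (subst (length π ≤_) sum≡n (length≤sum π (proj₂ pπ)))

  weighs : weight D ((α , β) ∷ []) ≡ n
  weighs = begin
    ((sumᴸ α + sumᴸ β) + 0) + D * D         ≡⟨ cong (λ z → ((z + sumᴸ β) + 0) + D * D) (sum-conjugate γ) ⟩
    ((sumᴸ γ + sumᴸ β) + 0) + D * D         ≡⟨ rearrange (sumᴸ γ) (sumᴸ β) D ⟩
    (D * D + sumᴸ γ) + sumᴸ β               ≡⟨ cong (λ l → (l * D + sumᴸ γ) + sumᴸ β) length-γ ⟨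
    (length γ * D + sumᴸ γ) + sumᴸ β        ≡⟨ cong (_+ sumᴸ β) (sum-map-+ D γ) ⟨
    sumᴸ (map (D +_) γ) + sumᴸ β            ≡⟨ cong (λ z → sumᴸ z + sumᴸ β) shift-back ⟩
    sumᴸ τ + sumᴸ β                         ≡⟨ sum-++ τ β ⟨
    sumᴸ (τ ++ β)                           ≡⟨ cong sumᴸ (take++drop≡id D π) ⟩
    sumᴸ π                                  ≡⟨ sum≡n ⟩
    n                                       ∎
    where
    open ≡-Reasoning
    rearrange : ∀ x y D → ((x + y) + 0) + D * D ≡ (D * D + x) + y
    rearrange = solve-∀

  partition-α : IsPartition α
  partition-α = partition-conjugate γ

  partition-β : IsPartition β
  partition-β = partition-drop D π pπ

  bounded-α : All (_≤ D) α
  bounded-α = at-All α (λ _ → ≤-trans (nonincreasing-mono α (proj₁ partition-α) z≤n)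
                (subst (_≤ D) (at-0 α) (subst (largest α ≤_) length-γ (largest-conjugate≤ γ))))

  bounded-β : All (_≤ D) β
  bounded-β = at-All β (λ {j} _ → subst (_≤ D) (sym (at-drop D π j))
                (≤-trans (nonincreasing-mono π decreasing-π (m≤m+n D j)) edge))

  -- l(α) = π₁ − D and l(β) = l(π) − D, so the rank is preserved.
  rank-preserved : length α ≡ m + length β
  rank-preserved = by-side D refl
    where
    length-α : length α ≡ at γ 0
    length-α = trans (length-conjugate γ decreasing-γ) (at-0 γ)
    by-side : ∀ d → D ≡ d → length α ≡ m + length β
    by-side zero D≡0 =
      let π₁≤0 : at π 0 ≤ 0
          π₁≤0 = subst (λ z → at π z ≤ z) D≡0 edge
          m+l≡0 : m + length π ≡ 0
          m+l≡0 = n≤0⇒n≡0 (subst (_≤ 0) (trans (sym (at-0 π)) rank≡m) π₁≤0)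
          γ₁≡0 : at γ 0 ≡ 0
          γ₁≡0 = at-beyond γ (≤-reflexive (trans length-γ D≡0))
      in trans length-α (trans γ₁≡0 (sym (trans (cong (m +_) (trans (length-drop D π) (cong (length π ∸_) D≡0))) m+l≡0)))
    by-side (suc _) D≡1+d = begin
      length α                  ≡⟨ length-α ⟩
      at γ 0                    ≡⟨ at-map (_∸ D) τ (subst (0 <_) (sym (trans length-τ D≡1+d)) (s≤s z≤n)) ⟩
      at τ 0 ∸ D                ≡⟨ cong (_∸ D) (at-take D π (subst (0 <_) (sym D≡1+d) (s≤s z≤n))) ⟩
      at π 0 ∸ D                ≡⟨ cong (_∸ D) (trans (sym (at-0 π)) rank≡m) ⟩
      (m + length π) ∸ D        ≡⟨ +-∸-assoc m within ⟩
      m + (length π ∸ D)        ≡⟨ cong (m +_) (length-drop D π) ⟨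
      m + length β              ∎
      where open ≡-Reasoning

  last-pair : Last D α β m
  last-pair = record { boundedα = bounded-α ; boundedβ = bounded-β ; ranked = rank-preserved }

isPartitionOf : ℤ.ℤ → ℕ → Partition → Bool
isPartitionOf r n π = (sumᴸ π ≡ᵇ n) ∧ ⌊ rank π ℤ.≟ r ⌋

durfee-count : ∀ m n → Dss 1 (m ∷ []) n ≡ N (ℤ.+ m) n
durfee-count m n =
  count-by-correspondence (isSymbol 1 (m ∷ []) n) (isPartitionOf (ℤ.+ m) n)
    (candidates-unique 1 n) (partitions-unique n)
    record { to = to ; from = from ; to-ok = to-ok ; from-ok = from-ok ; from∘to = from∘to ; to∘from = to∘from }
  where
  to : ℕ × Vec Pair 1 → Partition
  to (D , p ∷ []) = toPartition D p

  from : Partition → ℕ × Vec Pair 1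
  from π = proj₁ (fromPartition π) , proj₂ (fromPartition π) ∷ []

  single : ∀ {D α β} → Symbol D ((α , β) ∷ []) (m ∷ []) → Last D α β m
  single (last L) = L

  module OfSymbol {D α β} (selected : (D , (α , β) ∷ []) ∈ candidates 1 n ∣ isSymbol 1 (m ∷ []) n) where
    open Counted (counted⁻ {ms = m ∷ []} selected) public
    open SymbolPartition (proj₁ (pairs⁻ n (VecAll.head pairs))) (proj₂ (pairs⁻ n (VecAll.head pairs)))
                         (single symbol) public

  module OfPartition {π} (selected : π ∈ partitionsUpTo n ∣ isPartitionOf (ℤ.+ m) n) where
    tests : T (sumᴸ π ≡ᵇ n) × T ⌊ rank π ℤ.≟ ℤ.+ m ⌋
    tests = ∧⁻ (sumᴸ π ≡ᵇ n) (proj₂ selected)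
    open PartitionSymbol (proj₁ (partitions⁻ n (proj₁ selected))) (≡ᵇ⇒≡ _ n (proj₁ tests))
                         (rank⁻ (largest π) (length π) m (proj₂ tests)) public

  to-ok : ∀ {x} → x ∈ candidates 1 n ∣ isSymbol 1 (m ∷ []) n → to x ∈ partitionsUpTo n ∣ isPartitionOf (ℤ.+ m) n
  to-ok {D , (α , β) ∷ []} selected =
    partitions⁺ n partition-π (≤-reflexive sum≡n) ,
    ∧⁺ (≡⇒≡ᵇ _ n sum≡n) (⇒rank (largest π) (length π) m rank-π)
    where
    open OfSymbol selected
    sum≡n : sumᴸ π ≡ n
    sum≡n = trans sum-π weighs

  from-ok : ∀ {π} → π ∈ partitionsUpTo n ∣ isPartitionOf (ℤ.+ m) n → from π ∈ candidates 1 n ∣ isSymbol 1 (m ∷ []) n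
  from-ok selected = counted⁺ {ms = m ∷ []} record
    { D≤n    = D≤n
    ; pairs  = pairs⁺ n partition-α partition-β (≤-trans (pair-weight≤ D α β []) (≤-reflexive weighs))
               VecAll.∷ VecAll.[]
    ; weighs = weighs
    ; symbol = last last-pair }
    where open OfPartition selected

  from∘to : ∀ {x} → x ∈ candidates 1 n ∣ isSymbol 1 (m ∷ []) n → from (to x) ≡ x
  from∘to {D , (α , β) ∷ []} selected = cong (λ s → proj₁ s , proj₂ s ∷ []) (OfSymbol.from-to selected)

  to∘from : ∀ {π} → π ∈ partitionsUpTo n ∣ isPartitionOf (ℤ.+ m) n → to (from π) ≡ π
  to∘from selected = OfPartition.to-from selected

merge-all : ∀ k (ms : Vec ℕ (suc k)) n → Dss (suc k) ms n ≡ Dss 1 ((sum ms + k) ∷ []) n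
merge-all zero    (m ∷ [])          n = cong (λ r → Dss 1 (r ∷ []) n) (sym (trans (+-identityʳ (m + 0)) (+-identityʳ m)))
merge-all (suc k) (m₁ ∷ m₂ ∷ ms) n = begin
  Dss (2 + k) (m₁ ∷ m₂ ∷ ms) n                   ≡⟨ merge-count k m₁ m₂ ms n ⟩
  Dss (suc k) (suc (m₁ + m₂) ∷ ms) n             ≡⟨ merge-all k (suc (m₁ + m₂) ∷ ms) n ⟩
  Dss 1 ((suc (m₁ + m₂) + sum ms + k) ∷ []) n    ≡⟨ cong (λ r → Dss 1 (r ∷ []) n) (total m₁ m₂ (sum ms) k) ⟩
  Dss 1 ((m₁ + (m₂ + sum ms) + suc k) ∷ []) n    ∎
  where
  open ≡-Reasoning
  total : ∀ a b s k → suc (a + b) + s + k ≡ a + (b + s) + suc k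
  total = solve-∀

corollary2p2 : (k : ℕ) → 1 ≤ k → (ms : Vec ℕ k) → (n : ℕ) →
    Dss k ms n ≡ N (ℤ.+ (sum ms + k ∸ 1)) n
corollary2p2 (suc k) _ ms n = begin
  Dss (suc k) ms n                  ≡⟨ merge-all k ms n ⟩
  Dss 1 ((sum ms + k) ∷ []) n       ≡⟨ durfee-count (sum ms + k) n ⟩
  N (ℤ.+ (sum ms + k)) n            ≡⟨ cong (λ r → N (ℤ.+ r) n) (cong (_∸ 1) (+-suc (sum ms) k)) ⟨
  N (ℤ.+ (sum ms + suc k ∸ 1)) n    ∎
  where open ≡-Reasoning
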